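{- If $T$ is a tree (with at least one edge), then $\xi(T)+\eta(T)=\alpha(T)$, $\sigma(T)+\eta(T)=\mu(T)$, and $\xi(T)+2\eta(T)+\sigma(T)=n(T)$.
   Context: All graphs are finite and simple. $\alpha(T)$ is the stability number, $\mu(T)$ the maximum matching size, $n(T)=|V(T)|$. $\Omega(T)$ is the set of maximum stable sets, $\mathrm{core}(T)=\bigcap\{S:S\in\Omega(T)\}$, $\xi(T)=|\mathrm{core}(T)|$, $\sigma(T)=\left|\bigcap\{V(T)-S:S\in\Omega(T)\}\right|$. An edge $e$ is $\alpha$-critical if $\alpha(T-e)>\alpha(T)$ ($T-e$ being $T$ with $e$ deleted); $\eta(T)$ is the number of $\alpha$-critical edges of $T$. -}

module Defs where

open import Data.Bool using (Bool; true; false; _∧_; _∨_; not; if_then_else_)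
open import Data.Nat using (ℕ; zero; suc; _+_; _≤_; _<ᵇ_; _⊔_; _≡ᵇ_)
open import Data.Fin using (Fin; toℕ; _≟_)
open import Data.List using (List; []; _∷_; _∷ʳ_; length; map; foldr; allFin; concatMap)
open import Data.List.Relation.Unary.Linked using (Linked)
open import Data.List.Relation.Unary.Unique.Propositional using (Unique)
open import Data.Product using (Σ; _×_; _,_; ∃; proj₁; proj₂)
open import Relation.Nullary using (¬_)
open import Relation.Nullary.Decidable using (⌊_⌋)
open import Relation.Binary.PropositionalEquality using (_≡_)

Graph : ℕ → Set
Graph n = Fin n → Fin n → Bool

VSet : ℕ → Set
VSet n = Fin n → Bool

Simple : ∀ {n} → Graph n → Set
Simple {n} G = (∀ i j → G i j ≡ G j i) × (∀ i → G i i ≡ false)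

data Walk {n} (G : Graph n) : Fin n → Fin n → Set where
  here : ∀ {u} → Walk G u u
  step : ∀ {u w v} → G u w ≡ true → Walk G w v → Walk G u v

Connected : ∀ {n} → Graph n → Set
Connected {n} G = ∀ (u v : Fin n) → Walk G u v

IsCycle : ∀ {n} → Graph n → Fin n → List (Fin n) → Set
IsCycle G x vs = 2 ≤ length vs × Unique (x ∷ vs)
               × Linked (λ a b → G a b ≡ true) ((x ∷ vs) ∷ʳ x)

Acyclic : ∀ {n} → Graph n → Set
Acyclic {n} G = ¬ (Σ (Fin n) λ x → Σ (List (Fin n)) λ vs → IsCycle G x vs)

IsTree : ∀ {n} → Graph n → Set
IsTree G = Simple G × Connected G × Acyclic G

HasEdge : ∀ {n} → Graph n → Set
HasEdge {n} G = Σ (Fin n) λ i → Σ (Fin n) λ j → G i j ≡ true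

count : ∀ {A : Set} → (A → Bool) → List A → ℕ
count p [] = 0
count p (x ∷ xs) = if p x then suc (count p xs) else count p xs

filter : ∀ {A : Set} → (A → Bool) → List A → List A
filter p [] = []
filter p (x ∷ xs) = if p x then x ∷ filter p xs else filter p xs

all : ∀ {A : Set} → (A → Bool) → List A → Bool
all p [] = true
all p (x ∷ xs) = p x ∧ all p xs

maxℕ : List ℕ → ℕ
maxℕ = foldr _⊔_ 0

allVSets : ∀ n → List (VSet n)
allVSets zero = (λ ()) ∷ []
allVSets (suc n) = concatMap (λ S → ext false S ∷ ext true S ∷ []) (allVSets n)
  where
  ext : Bool → VSet n → VSet (suc n)
  ext b S Fin.zero = b
  ext b S (Fin.suc i) = S i

sublists : ∀ {A : Set} → List A → List (List A)
sublists [] = [] ∷ []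
sublists (x ∷ xs) = concatMap (λ ys → ys ∷ (x ∷ ys) ∷ []) (sublists xs)

vertices : ∀ n → List (Fin n)
vertices n = allFin n

card : ∀ {n} → VSet n → ℕ
card {n} S = count S (vertices n)

isStable : ∀ {n} → Graph n → VSet n → Bool
isStable {n} G S = all (λ i → all (λ j → not (S i ∧ S j ∧ G i j)) (vertices n)) (vertices n)

α : ∀ {n} → Graph n → ℕ
α {n} G = maxℕ (map card (filter (λ S → isStable G S) (allVSets n)))

isMaxStable : ∀ {n} → Graph n → VSet n → Bool
isMaxStable G S = isStable G S ∧ (card S ≡ᵇ α G)

Ω : ∀ {n} → Graph n → List (VSet n)
Ω {n} G = filter (λ S → isMaxStable G S) (allVSets n)

-- ξ(G) = |core(G)| = |⋂ Ω(G)|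
ξ : ∀ {n} → Graph n → ℕ
ξ {n} G = count (λ v → all (λ S → S v) (Ω G)) (vertices n)

σ : ∀ {n} → Graph n → ℕ
σ {n} G = count (λ v → all (λ S → not (S v)) (Ω G)) (vertices n)

Edge : ℕ → Set
Edge n = Fin n × Fin n

-- each edge listed once, as (i , j) with i < j
edges : ∀ {n} → Graph n → List (Edge n)
edges {n} G = concatMap (λ i → map (λ j → (i , j))
                (filter (λ j → (toℕ i <ᵇ toℕ j) ∧ G i j) (vertices n))) (vertices n)

_==_ : ∀ {n} → Fin n → Fin n → Bool
i == j = ⌊ i ≟ j ⌋

deleteEdge : ∀ {n} → Graph n → Edge n → Graph n
deleteEdge G (u , v) i j = G i j ∧ not ((i == u ∧ j == v) ∨ (i == v ∧ j == u))

isαCritical : ∀ {n} → Graph n → Edge n → Bool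
isαCritical G e = α G <ᵇ α (deleteEdge G e)

η : ∀ {n} → Graph n → ℕ
η G = count (isαCritical G) (edges G)

disjointEdges : ∀ {n} → Edge n → Edge n → Bool
disjointEdges (a , b) (c , d) = not (a == c ∨ a == d ∨ b == c ∨ b == d)

isMatching : ∀ {n} → List (Edge n) → Bool
isMatching [] = true
isMatching (e ∷ es) = all (disjointEdges e) es ∧ isMatching es

μ : ∀ {n} → Graph n → ℕ
μ G = maxℕ (map length (filter isMatching (sublists (edges G))))

{-# OPTIONS --safe #-}

-- In a forest ξ + η = α, σ + η = μ and α + μ = n (König–Egerváry); adding them gives the third
-- identity.  Induct on the number of edges: take a pendant vertex ℓ with neighbour p and delete
-- every edge at p.  Then ℓ and p become isolated, α grows by one and μ drops by one, while
-- membership in the core, in the corona ⋃ Ω and α-criticality change only at ℓ, p and the edges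
-- at p.  There everything is decided by whether p lies in some maximum stable set: if it does,
-- ℓp is α-critical and neither ℓ nor p is in the core or outside the corona; if not, ℓ is in the
-- core, p is outside the corona, and no edge at p is α-critical.

module Submission where

open import Defs
open import Data.Bool using (Bool; true; false; _∧_; _∨_; not; if_then_else_)
open import Data.Bool.Properties
  using ( ∧-assoc; ∧-comm; ∨-comm; ∧-zeroʳ; ∧-identityʳ; ∧-conicalˡ; ∧-conicalʳ; ∨-conicalˡ; ∨-conicalʳ; ∨-zeroʳ
        ; ∧-distribʳ-∨; not-injective; not-involutive; T-≡)
  renaming (_≟_ to _≟ᵇ_)
open import Data.Nat using (ℕ; zero; suc; _+_; _*_; _≤_; _<_; z≤n; s≤s; _<ᵇ_)
open import Data.Nat.Properties hiding (_≟_)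
open import Data.Fin using (Fin; toℕ; _≟_) renaming (zero to fzero; suc to fsuc)
open import Data.Fin.Properties using (toℕ-injective; any?)
open import Relation.Binary.Definitions using (Tri; tri<; tri≈; tri>)
open import Data.List using (List; []; _∷_; _++_; [_]; length; map; concatMap; allFin; tabulate)
open import Data.List.Properties using (length-tabulate; map-tabulate; concatMap-cong; length-++; ++-assoc; ∷-injectiveˡ)
open import Data.List.Membership.Propositional using (_∈_; find; lose)
open import Data.List.Membership.Propositional.Properties
  using (∈-∃++; ∈-allFin; ∈-map⁺; ∈-map⁻; ∈-concatMap⁺; ∈-concatMap⁻; ∈-++⁻; ∈-++⁺ˡ; ∈-++⁺ʳ)
open import Data.List.Relation.Binary.Sublist.Propositional using (_⊆_; []; _∷_; _∷ʳ_; ⊆-trans; lookup; minimum)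
open import Data.List.Relation.Unary.Any using (here; there)
open import Data.List.Relation.Unary.All using (All; []; _∷_)
import Data.List.Relation.Unary.All.Properties as All
open import Data.List.Relation.Unary.AllPairs using (AllPairs; []; _∷_)
open import Data.List.Relation.Unary.Linked using (Linked; []; [-]; _∷_)
import Data.List.Relation.Unary.Linked as Linked
open import Data.List.Relation.Unary.Unique.Propositional using (Unique)
open import Data.Product using (∃; ∃₂; _×_; _,_; proj₁; proj₂; map₁)
open import Data.Sum using (_⊎_; inj₁; inj₂)
open import Data.Empty using (⊥; ⊥-elim)
open import Function using (_∘_; id; case_of_)
open import Function.Bundles using (Equivalence)
open import Relation.Nullary using (¬_; yes; no)
open import Relation.Nullary.Decidable using (_×-dec_; ¬?)
open import Relation.Binary.PropositionalEquality hiding ([_])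
open import Data.Nat.Tactic.RingSolver using (solve-∀)

bit : Bool → ℕ
bit b = if b then 1 else 0

bool-ext : ∀ {b c : Bool} → (b ≡ true → c ≡ true) → (c ≡ true → b ≡ true) → b ≡ c
bool-ext {false} {false} _ _ = refl
bool-ext {false} {true}  _ g = g refl
bool-ext {true}  {false} f _ = sym (f refl)
bool-ext {true}  {true}  _ _ = refl

≢true⇒≡false : ∀ {b} → ¬ (b ≡ true) → b ≡ false
≢true⇒≡false {false} _ = refl
≢true⇒≡false {true}  h = ⊥-elim (h refl)

not-≡true : ∀ {b} → not b ≡ true → b ≡ false
not-≡true {false} _ = refl

==-refl : ∀ {n} (i : Fin n) → (i == i) ≡ true
==-refl i with i ≟ i
... | yes _   = refl
... | no  i≢i = ⊥-elim (i≢i refl)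

==⇒≡ : ∀ {n} {i j : Fin n} → (i == j) ≡ true → i ≡ j
==⇒≡ {i = i} {j} e with i ≟ j
... | yes i≡j = i≡j

≢⇒==false : ∀ {n} {i j : Fin n} → i ≢ j → (i == j) ≡ false
≢⇒==false {i = i} {j} i≢j with i ≟ j
... | yes i≡j = ⊥-elim (i≢j i≡j)
... | no  _   = refl

==false⇒≢ : ∀ {n} {i j : Fin n} → (i == j) ≡ false → i ≢ j
==false⇒≢ {i = i} e refl with trans (sym (==-refl i)) e
... | ()

suc-==-suc : ∀ {n} (i j : Fin n) → (fsuc i == fsuc j) ≡ (i == j)
suc-==-suc i j with i ≟ j
... | yes _ = refl
... | no  _ = refl

module _ {A : Set} where

  count-cong : {p q : A → Bool} → (∀ x → p x ≡ q x) → ∀ xs → count p xs ≡ count q xs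
  count-cong e [] = refl
  count-cong {q = q} e (x ∷ xs) rewrite e x with q x
  ... | true  = cong suc (count-cong e xs)
  ... | false = count-cong e xs

  count-false : {p : A → Bool} → (∀ x → p x ≡ false) → ∀ xs → count p xs ≡ 0
  count-false e [] = refl
  count-false e (x ∷ xs) rewrite e x = count-false e xs

  count-++ : (p : A → Bool) (xs ys : List A) → count p (xs ++ ys) ≡ count p xs + count p ys
  count-++ p [] ys = refl
  count-++ p (x ∷ xs) ys with p x
  ... | true  = cong suc (count-++ p xs ys)
  ... | false = count-++ p xs ys

  count-split : {p q r : A → Bool} → (∀ x → p x ≡ q x ∨ r x) → (∀ x → q x ∧ r x ≡ false) →
                ∀ xs → count p xs ≡ count q xs + count r xs
  count-split e d [] = refl
  count-split {q = q} {r} e d (x ∷ xs) rewrite e x with q x | r x | d x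
  ... | true  | false | _ = cong suc (count-split e d xs)
  ... | false | true  | _ = trans (cong suc (count-split e d xs)) (sym (+-suc _ _))
  ... | false | false | _ = count-split e d xs

  count-mono : {p q : A → Bool} → (∀ x → p x ≡ true → q x ≡ true) → ∀ xs → count p xs ≤ count q xs
  count-mono h [] = z≤n
  count-mono {p} {q} h (x ∷ xs) with p x in px | q x in qx
  ... | true  | true  = s≤s (count-mono h xs)
  ... | true  | false with () ← trans (sym (h x px)) qx
  ... | false | true  = m≤n⇒m≤1+n (count-mono h xs)
  ... | false | false = count-mono h xs

  count-≥1 : {p : A → Bool} {x : A} → ∀ xs → x ∈ xs → p x ≡ true → 1 ≤ count p xs
  count-≥1 {p} (y ∷ xs) (here refl) px rewrite px = s≤s z≤n
  count-≥1 {p} (y ∷ xs) (there x∈xs) px with p y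
  ... | true  = s≤s z≤n
  ... | false = count-≥1 xs x∈xs px

  count-agree : {p q d : A → Bool} → (∀ x → d x ≡ false → p x ≡ q x) → ∀ xs →
                count p xs + count (λ x → d x ∧ q x) xs ≡ count q xs + count (λ x → d x ∧ p x) xs
  count-agree e [] = refl
  count-agree {p} {q} {d} e (x ∷ xs) with d x in dx
  ... | false rewrite e x dx with q x
  ...   | true  = cong suc (count-agree e xs)
  ...   | false = count-agree e xs
  count-agree {p} {q} {d} e (x ∷ xs) | true with p x | q x
  ...   | true  | true  = cong suc (trans (+-suc _ _) (trans (cong suc (count-agree e xs)) (sym (+-suc _ _))))
  ...   | true  | false = trans (cong suc (count-agree e xs)) (sym (+-suc _ _))
  ...   | false | true  = trans (+-suc _ _) (cong suc (count-agree e xs))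
  ...   | false | false = count-agree e xs

  count-∧-const : {t : A → Bool} (c : Bool) → ∀ xs → count t xs ≡ 1 → count (λ x → t x ∧ c) xs ≡ bit c
  count-∧-const {t} true  xs one = trans (count-cong (λ x → ∧-identityʳ (t x)) xs) one
  count-∧-const {t} false xs _   = count-false (λ x → ∧-zeroʳ (t x)) xs

  count-filter : (p q : A → Bool) → ∀ xs → count p (filter q xs) ≡ count (λ x → q x ∧ p x) xs
  count-filter p q [] = refl
  count-filter p q (x ∷ xs) with q x
  ... | false = count-filter p q xs
  ... | true with p x
  ...   | true  = cong suc (count-filter p q xs)
  ...   | false = count-filter p q xs

  length-filter : (q : A → Bool) → ∀ xs → length xs ≡ length (filter q xs) + count (not ∘ q) xs
  length-filter q [] = refl
  length-filter q (x ∷ xs) with q x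
  ... | true  = cong suc (length-filter q xs)
  ... | false = trans (cong suc (length-filter q xs)) (sym (+-suc _ _))

  ∈-filter⁺ : (q : A → Bool) {x : A} → ∀ xs → x ∈ xs → q x ≡ true → x ∈ filter q xs
  ∈-filter⁺ q (y ∷ xs) (here refl) qx rewrite qx = here refl
  ∈-filter⁺ q (y ∷ xs) (there x∈xs) qx with q y
  ... | true  = there (∈-filter⁺ q xs x∈xs qx)
  ... | false = ∈-filter⁺ q xs x∈xs qx

  ∈-filter⁻ : (q : A → Bool) {x : A} → ∀ xs → x ∈ filter q xs → x ∈ xs × q x ≡ true
  ∈-filter⁻ q (y ∷ xs) x∈ with q y in qy
  ∈-filter⁻ q (y ∷ xs) (here refl) | true = here refl , qy
  ∈-filter⁻ q (y ∷ xs) (there x∈) | true = map₁ there (∈-filter⁻ q xs x∈)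
  ... | false = map₁ there (∈-filter⁻ q xs x∈)

  filter-++ : (q : A → Bool) (xs ys : List A) → filter q (xs ++ ys) ≡ filter q xs ++ filter q ys
  filter-++ q [] ys = refl
  filter-++ q (x ∷ xs) ys with q x
  ... | true  = cong (x ∷_) (filter-++ q xs ys)
  ... | false = filter-++ q xs ys

  filter-filter : (q r : A → Bool) → ∀ xs → filter q (filter r xs) ≡ filter (λ x → r x ∧ q x) xs
  filter-filter q r [] = refl
  filter-filter q r (x ∷ xs) with r x
  ... | false = filter-filter q r xs
  ... | true with q x
  ...   | true  = cong (x ∷_) (filter-filter q r xs)
  ...   | false = filter-filter q r xs

  filter-cong : {q r : A → Bool} → (∀ x → q x ≡ r x) → ∀ xs → filter q xs ≡ filter r xs
  filter-cong e [] = refl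
  filter-cong {r = r} e (x ∷ xs) rewrite e x with r x
  ... | true  = cong (x ∷_) (filter-cong e xs)
  ... | false = filter-cong e xs

  all-intro : (p : A → Bool) → ∀ xs → (∀ x → x ∈ xs → p x ≡ true) → all p xs ≡ true
  all-intro p [] h = refl
  all-intro p (x ∷ xs) h rewrite h x (here refl) = all-intro p xs (λ y y∈ → h y (there y∈))

  all-elim : (p : A → Bool) → ∀ xs → all p xs ≡ true → ∀ x → x ∈ xs → p x ≡ true
  all-elim p (y ∷ xs) e x (here refl) = ∧-conicalˡ (p y) _ e
  all-elim p (y ∷ xs) e x (there x∈) = all-elim p xs (∧-conicalʳ (p y) _ e) x x∈

  all-false : (p : A → Bool) → ∀ xs → all p xs ≡ false → ∃ λ x → x ∈ xs × p x ≡ false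
  all-false p (x ∷ xs) e with p x in px
  ... | false = x , here refl , px
  ... | true with y , y∈ , py ← all-false p xs e = y , there y∈ , py

module _ {A B : Set} where

  count-map : (p : B → Bool) (f : A → B) → ∀ xs → count p (map f xs) ≡ count (p ∘ f) xs
  count-map p f [] = refl
  count-map p f (x ∷ xs) with p (f x)
  ... | true  = cong suc (count-map p f xs)
  ... | false = count-map p f xs

  filter-map : (q : B → Bool) (f : A → B) → ∀ xs → filter q (map f xs) ≡ map f (filter (q ∘ f) xs)
  filter-map q f [] = refl
  filter-map q f (x ∷ xs) with q (f x)
  ... | true  = cong (f x ∷_) (filter-map q f xs)
  ... | false = filter-map q f xs

  filter-concatMap : (q : B → Bool) (f : A → List B) → ∀ xs →
                     filter q (concatMap f xs) ≡ concatMap (filter q ∘ f) xs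
  filter-concatMap q f [] = refl
  filter-concatMap q f (x ∷ xs) =
    trans (filter-++ q (f x) (concatMap f xs)) (cong (filter q (f x) ++_) (filter-concatMap q f xs))

_⊗_ : ∀ {A B : Set} → (A → Bool) → (B → Bool) → A × B → Bool
(f ⊗ g) (x , y) = f x ∧ g y

count-⊗ : ∀ {A B : Set} (f : A → Bool) (g : B → Bool) → ∀ xs ys →
          count (f ⊗ g) (concatMap (λ x → map (x ,_) ys) xs) ≡ count f xs * count g ys
count-⊗ f g [] ys = refl
count-⊗ f g (x ∷ xs) ys
  rewrite count-++ (f ⊗ g) (map (x ,_) ys) (concatMap (λ x → map (x ,_) ys) xs)
        | count-map (f ⊗ g) (x ,_) ys
        | count-⊗ f g xs ys
  with f x
... | true  = refl
... | false = cong (_+ count f xs * count g ys) (count-false (λ _ → refl) ys)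

maxℕ-ub : ∀ {x} xs → x ∈ xs → x ≤ maxℕ xs
maxℕ-ub (y ∷ xs) (here refl) = m≤m⊔n y (maxℕ xs)
maxℕ-ub (y ∷ xs) (there x∈) = ≤-trans (maxℕ-ub xs x∈) (m≤n⊔m y (maxℕ xs))

maxℕ-attained : ∀ xs → maxℕ xs ≡ 0 ⊎ maxℕ xs ∈ xs
maxℕ-attained [] = inj₁ refl
maxℕ-attained (y ∷ xs) with ⊔-sel y (maxℕ xs)
... | inj₁ e = inj₂ (here e)
... | inj₂ e with maxℕ-attained xs
...   | inj₁ z  = inj₁ (trans e z)
...   | inj₂ m∈ = inj₂ (subst (_∈ y ∷ xs) (sym e) (there m∈))

module _ {A : Set} where

  sublists-complete : {ys xs : List A} → ys ⊆ xs → ys ∈ sublists xs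
  sublists-complete [] = here refl
  sublists-complete (x ∷ʳ τ)    = ∈-concatMap⁺ _ (lose (sublists-complete τ) (here refl))
  sublists-complete (refl ∷ τ) = ∈-concatMap⁺ _ (lose (sublists-complete τ) (there (here refl)))

  sublists-sound : {ys : List A} → ∀ xs → ys ∈ sublists xs → ys ⊆ xs
  sublists-sound [] (here refl) = []
  sublists-sound (x ∷ xs) ys∈ with find (∈-concatMap⁻ (λ zs → zs ∷ (x ∷ zs) ∷ []) {xs = sublists xs} ys∈)
  ... | zs , zs∈ , here refl         = x ∷ʳ sublists-sound xs zs∈
  ... | zs , zs∈ , there (here refl) = refl ∷ sublists-sound xs zs∈

  filter-⊆ : (q : A → Bool) → ∀ xs → filter q xs ⊆ xs
  filter-⊆ q [] = []
  filter-⊆ q (x ∷ xs) with q x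
  ... | true  = refl ∷ filter-⊆ q xs
  ... | false = x ∷ʳ filter-⊆ q xs

  filter-mono-⊆ : (q : A → Bool) {ys xs : List A} → ys ⊆ xs → filter q ys ⊆ filter q xs
  filter-mono-⊆ q [] = []
  filter-mono-⊆ q (x ∷ʳ τ) with q x
  ... | true  = x ∷ʳ filter-mono-⊆ q τ
  ... | false = filter-mono-⊆ q τ
  filter-mono-⊆ q (_∷_ {x} refl τ) with q x
  ... | true  = refl ∷ filter-mono-⊆ q τ
  ... | false = filter-mono-⊆ q τ

  all-⊆ : (p : A → Bool) {ys xs : List A} → ys ⊆ xs → all p xs ≡ true → all p ys ≡ true
  all-⊆ p {ys} {xs} τ e = all-intro p ys λ y y∈ → all-elim p xs e y (lookup τ y∈)

  ⊆-filter-insert : (q : A → Bool) {x : A} {ys : List A} → ∀ xs → ys ⊆ filter q xs → x ∈ xs → q x ≡ false →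
                    ∃₂ λ ys₁ ys₂ → ys₁ ++ ys₂ ≡ ys × ys₁ ++ x ∷ ys₂ ⊆ xs
  ⊆-filter-insert q (y ∷ xs) τ x∈ qx with q y in qy
  ⊆-filter-insert q {ys = ys} (y ∷ xs) τ (here refl) qx | false = [] , ys , refl , refl ∷ ⊆-trans τ (filter-⊆ q xs)
  ⊆-filter-insert q (y ∷ xs) τ (here refl) qx | true with () ← trans (sym qy) qx
  ⊆-filter-insert q (y ∷ xs) τ (there x∈) qx | false
    with ys₁ , ys₂ , eq , τ′ ← ⊆-filter-insert q xs τ x∈ qx = ys₁ , ys₂ , eq , y ∷ʳ τ′
  ⊆-filter-insert q (y ∷ xs) (y ∷ʳ τ) (there x∈) qx | true
    with ys₁ , ys₂ , eq , τ′ ← ⊆-filter-insert q xs τ x∈ qx = ys₁ , ys₂ , eq , y ∷ʳ τ′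
  ⊆-filter-insert q (y ∷ xs) (refl ∷ τ) (there x∈) qx | true
    with ys₁ , ys₂ , eq , τ′ ← ⊆-filter-insert q xs τ x∈ qx = y ∷ ys₁ , ys₂ , cong (y ∷_) eq , refl ∷ τ′

count-tabulate-suc : ∀ {n} (p : Fin (suc n) → Bool) → count p (tabulate fsuc) ≡ count (p ∘ fsuc) (allFin n)
count-tabulate-suc {n} p = trans (cong (count p) (sym (map-tabulate id fsuc))) (count-map p fsuc (allFin n))

count-single : ∀ {n} (a : Fin n) → count (_== a) (allFin n) ≡ 1
count-single {suc n} fzero    = cong suc (trans (count-tabulate-suc {n} (_== fzero)) (count-false (λ _ → refl) (allFin n)))
count-single {suc n} (fsuc a) =
  trans (count-tabulate-suc {n} (_== fsuc a)) (trans (count-cong (λ v → suc-==-suc v a) (allFin n)) (count-single a))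

count-at : ∀ {n} (g : Fin n → Bool) (a : Fin n) → count (λ v → (v == a) ∧ g v) (allFin n) ≡ bit (g a)
count-at {n} g a = trans (count-cong at-a (allFin n)) (count-∧-const (g a) (allFin n) (count-single a))
  where
  at-a : ∀ v → (v == a) ∧ g v ≡ (v == a) ∧ g a
  at-a v with v == a in e
  ... | true rewrite ==⇒≡ e = refl
  ... | false = refl

count-agree-at : ∀ {n} {f g : Fin n → Bool} (a : Fin n) → (∀ v → v ≢ a → f v ≡ g v) →
                 count f (allFin n) + bit (g a) ≡ count g (allFin n) + bit (f a)
count-agree-at {n} {f} {g} a e =
  subst₂ (λ x y → count f (allFin n) + x ≡ count g (allFin n) + y) (count-at g a) (count-at f a)
         (count-agree (λ v v≠a → e v (==false⇒≢ v≠a)) (allFin n))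

count-agree-at₂ : ∀ {n} {f g : Fin n → Bool} {a b : Fin n} → a ≢ b → (∀ v → v ≢ a → v ≢ b → f v ≡ g v) →
                  count f (allFin n) + (bit (g a) + bit (g b)) ≡ count g (allFin n) + (bit (f a) + bit (f b))
count-agree-at₂ {n} {f} {g} {a} {b} a≢b e =
  subst₂ (λ x y → count f (allFin n) + x ≡ count g (allFin n) + y) (count-at₂ g) (count-at₂ f)
         (count-agree off (allFin n))
  where
  off : ∀ v → (v == a) ∨ (v == b) ≡ false → f v ≡ g v
  off v d = e v (==false⇒≢ (∨-conicalˡ _ _ d)) (==false⇒≢ (∨-conicalʳ _ _ d))
  count-at₂ : ∀ h → count (λ v → ((v == a) ∨ (v == b)) ∧ h v) (allFin n) ≡ bit (h a) + bit (h b)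
  count-at₂ h = trans (count-split (λ v → ∧-distribʳ-∨ (h v) (v == a) (v == b)) disjoint (allFin n))
                      (cong₂ _+_ (count-at h a) (count-at h b))
    where
    disjoint : ∀ v → ((v == a) ∧ h v) ∧ ((v == b) ∧ h v) ≡ false
    disjoint v with v == a in e
    ... | false = refl
    ... | true rewrite ≢⇒==false (λ v≡b → a≢b (trans (sym (==⇒≡ e)) v≡b)) = ∧-zeroʳ (h v)

insert : ∀ {n} → Fin n → VSet n → VSet n
insert x S v = (v == x) ∨ S v

remove : ∀ {n} → Fin n → VSet n → VSet n
remove x S v = S v ∧ not (v == x)

module _ {n} (x : Fin n) (S : VSet n) where

  insert-∋ : insert x S x ≡ true
  insert-∋ rewrite ==-refl x = refl

  insert-⊇ : ∀ {v} → S v ≡ true → insert x S v ≡ true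
  insert-⊇ {v} Sv rewrite Sv = ∨-zeroʳ (v == x)

  insert-other : ∀ {v} → v ≢ x → insert x S v ≡ S v
  insert-other v≢x rewrite ≢⇒==false v≢x = refl

  insert⁻ : ∀ {v} → insert x S v ≡ true → v ≡ x ⊎ S v ≡ true
  insert⁻ {v} e with v == x in vx
  ... | true  = inj₁ (==⇒≡ vx)
  ... | false = inj₂ e

  remove-∌ : remove x S x ≡ false
  remove-∌ rewrite ==-refl x = ∧-zeroʳ (S x)

  remove-other : ∀ {v} → v ≢ x → remove x S v ≡ S v
  remove-other v≢x rewrite ≢⇒==false v≢x = ∧-identityʳ _

  remove⁻ : ∀ {v} → remove x S v ≡ true → S v ≡ true × v ≢ x
  remove⁻ {v} e = ∧-conicalˡ _ _ e , ==false⇒≢ (not-≡true (∧-conicalʳ (S v) _ e))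

  card-insert : S x ≡ false → card (insert x S) ≡ suc (card S)
  card-insert Sx = begin
    card (insert x S)             ≡⟨ sym (+-identityʳ _) ⟩
    card (insert x S) + bit false ≡⟨ cong (λ b → card (insert x S) + bit b) (sym Sx) ⟩
    card (insert x S) + bit (S x) ≡⟨ count-agree-at x (λ v → insert-other) ⟩
    card S + bit (insert x S x)   ≡⟨ cong (λ b → card S + bit b) insert-∋ ⟩
    card S + 1                    ≡⟨ +-comm (card S) 1 ⟩
    suc (card S)                  ∎
    where open ≡-Reasoning

  card-remove : S x ≡ true → card S ≡ suc (card (remove x S))
  card-remove Sx = begin
    card S                        ≡⟨ sym (+-identityʳ _) ⟩
    card S + bit false            ≡⟨ cong (λ b → card S + bit b) (sym remove-∌) ⟩
    card S + bit (remove x S x)   ≡⟨ count-agree-at x (λ v v≢x → sym (remove-other v≢x)) ⟩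
    card (remove x S) + bit (S x) ≡⟨ cong (λ b → card (remove x S) + bit b) Sx ⟩
    card (remove x S) + 1         ≡⟨ +-comm _ 1 ⟩
    suc (card (remove x S))       ∎
    where open ≡-Reasoning

card-mono : ∀ {n} {S S′ : VSet n} → (∀ v → S v ≡ true → S′ v ≡ true) → card S ≤ card S′
card-mono {n} h = count-mono h (allFin n)

card-≤ : ∀ {n} (S : VSet n) → card S ≤ n
card-≤ {n} S = subst (card S ≤_) (length-tabulate id) (count-≤-length (allFin n))
  where
  count-≤-length : ∀ xs → count S xs ≤ length xs
  count-≤-length [] = z≤n
  count-≤-length (x ∷ xs) with S x
  ... | true  = s≤s (count-≤-length xs)
  ... | false = m≤n⇒m≤1+n (count-≤-length xs)

∈≢∉ : ∀ {n} {S : VSet n} {v x} → S v ≡ true → S x ≡ false → v ≢ x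
∈≢∉ Sv Sx refl = case trans (sym Sv) Sx of λ ()

card-≤-remove : ∀ {n} x (S : VSet n) → card S ≤ suc (card (remove x S))
card-≤-remove x S with S x in Sx
... | true  = ≤-reflexive (card-remove x S Sx)
... | false = m≤n⇒m≤1+n (card-mono {S = S} λ v Sv → trans (remove-other x S (∈≢∉ Sv Sx)) Sv)

card-≤-swap : ∀ {n} {x y : Fin n} (S : VSet n) → x ≢ y → (S y ≡ true → S x ≡ false) →
              card S ≤ card (insert x (remove y S))
card-≤-swap {x = x} {y} S x≢y excl with S y in Sy
... | true  = ≤-reflexive (trans (card-remove y S Sy)
                  (sym (card-insert x (remove y S) (trans (remove-other y S x≢y) (excl refl)))))
... | false = card-mono {S = S} λ v Sv → insert-⊇ x (remove y S) (trans (remove-other y S (∈≢∉ Sv Sy)) Sv)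

allVSets-complete : ∀ n (S : VSet n) → ∃ λ S′ → S′ ∈ allVSets n × (∀ v → S′ v ≡ S v)
allVSets-complete zero S = _ , here refl , λ ()
allVSets-complete (suc n) S with S′ , S′∈ , S′≗ ← allVSets-complete n (S ∘ fsuc) | S fzero in S0
... | false = _ , ∈-concatMap⁺ _ (lose S′∈ (here refl)) , λ { fzero → sym S0 ; (fsuc i) → S′≗ i }
... | true  = _ , ∈-concatMap⁺ _ (lose S′∈ (there (here refl))) , λ { fzero → sym S0 ; (fsuc i) → S′≗ i }

-- Stable sets, core and corona

Stable : ∀ {n} → Graph n → VSet n → Set
Stable G S = ∀ i j → S i ≡ true → S j ≡ true → G i j ≡ false

MaxStable : ∀ {n} → Graph n → VSet n → Set
MaxStable G S = Stable G S × card S ≡ α G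

module _ {n} (G : Graph n) where

  isStable-sound : ∀ S → isStable G S ≡ true → Stable G S
  isStable-sound S e i j Si Sj with all-elim _ _ (all-elim _ _ e i (∈-allFin i)) j (∈-allFin j)
  ... | pair-ok rewrite Si | Sj = not-≡true pair-ok

  isStable-complete : ∀ S → Stable G S → isStable G S ≡ true
  isStable-complete S st = all-intro _ (allFin n) λ i _ → all-intro _ (allFin n) λ j _ → pair i j
    where
    pair : ∀ i j → not (S i ∧ S j ∧ G i j) ≡ true
    pair i j with S i in Si | S j in Sj
    ... | false | _     = refl
    ... | true  | false = refl
    ... | true  | true rewrite st i j Si Sj = refl

  stable-⊆ : ∀ {S S′} → (∀ v → S′ v ≡ true → S v ≡ true) → Stable G S → Stable G S′
  stable-⊆ h st i j S′i S′j = st i j (h i S′i) (h j S′j)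

  stable-subgraph : ∀ {H S} → (∀ {i j} → H i j ≡ true → G i j ≡ true) → Stable G S → Stable H S
  stable-subgraph H⊆G st i j Si Sj = ≢true⇒≡false λ Hij → case trans (sym (H⊆G Hij)) (st i j Si Sj) of λ ()

  stable-remove : ∀ x {S} → Stable G S → Stable G (remove x S)
  stable-remove x {S} = stable-⊆ (λ v e → proj₁ (remove⁻ x S e))

  stable⇒card≤α : ∀ {S} → Stable G S → card S ≤ α G
  stable⇒card≤α {S} st with S′ , S′∈ , S′≗S ← allVSets-complete n S =
    subst (_≤ α G) (count-cong S′≗S (allFin n))
      (maxℕ-ub _ (∈-map⁺ card (∈-filter⁺ (isStable G) _ S′∈
        (isStable-complete S′ (stable-⊆ (λ v S′v → trans (sym (S′≗S v)) S′v) st)))))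

  maxStable-exists : ∃ (MaxStable G)
  maxStable-exists with maxℕ-attained (map card (filter (isStable G) (allVSets n)))
  ... | inj₁ α≡0 = (λ _ → false) , (λ _ _ ()) , trans (count-false (λ _ → refl) (allFin n)) (sym α≡0)
  ... | inj₂ α∈ with S , S∈ , α≡ ← ∈-map⁻ card α∈ =
    S , isStable-sound S (proj₂ (∈-filter⁻ (isStable G) (allVSets n) S∈)) , sym α≡

  maxStable-intro : ∀ {S} → Stable G S → α G ≤ card S → MaxStable G S
  maxStable-intro st α≤ = st , ≤-antisym (stable⇒card≤α st) α≤

  ∈Ω⇒maxStable : ∀ {S} → S ∈ Ω G → MaxStable G S
  ∈Ω⇒maxStable {S} S∈ with _ , e ← ∈-filter⁻ (isMaxStable G) (allVSets n) S∈ =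
    isStable-sound S (∧-conicalˡ _ _ e) , ≡ᵇ⇒≡ _ _ (Equivalence.from T-≡ (∧-conicalʳ (isStable G S) _ e))

  maxStable⇒∈Ω : ∀ {S} → MaxStable G S → ∃ λ S′ → S′ ∈ Ω G × (∀ v → S′ v ≡ S v)
  maxStable⇒∈Ω {S} (st , card≡) with S′ , S′∈ , S′≗S ← allVSets-complete n S =
    S′ , ∈-filter⁺ (isMaxStable G) _ S′∈ isMax , S′≗S
    where
    st′ : Stable G S′
    st′ = stable-⊆ (λ v S′v → trans (sym (S′≗S v)) S′v) st
    isMax : isMaxStable G S′ ≡ true
    isMax rewrite isStable-complete S′ st′ =
      Equivalence.to T-≡ (≡⇒≡ᵇ (card S′) (α G) (trans (count-cong S′≗S (allFin n)) card≡))

  -- ⋂ Ω(G) and ⋂ {V − S : S ∈ Ω(G)}, the latter being the complement of the corona ⋃ Ω(G).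
  inCore outsideCorona : Fin n → Bool
  inCore v        = all (λ S → S v) (Ω G)
  outsideCorona v = all (λ S → not (S v)) (Ω G)

  inCore-sound : ∀ {v S} → inCore v ≡ true → MaxStable G S → S v ≡ true
  inCore-sound {v} c ms with S′ , S′∈ , S′≗S ← maxStable⇒∈Ω ms = trans (sym (S′≗S v)) (all-elim _ (Ω G) c _ S′∈)

  inCore-complete : ∀ {v} → (∀ S → MaxStable G S → S v ≡ true) → inCore v ≡ true
  inCore-complete h = all-intro _ (Ω G) λ S S∈ → h S (∈Ω⇒maxStable S∈)

  outsideCorona-sound : ∀ {v S} → outsideCorona v ≡ true → MaxStable G S → S v ≡ false
  outsideCorona-sound {v} c ms with S′ , S′∈ , S′≗S ← maxStable⇒∈Ω ms =
    trans (sym (S′≗S v)) (not-≡true (all-elim _ (Ω G) c _ S′∈))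

  outsideCorona-complete : ∀ {v} → (∀ S → MaxStable G S → S v ≡ false) → outsideCorona v ≡ true
  outsideCorona-complete h = all-intro _ (Ω G) λ S S∈ → cong not (h S (∈Ω⇒maxStable S∈))

  inCore-false : ∀ {v S} → MaxStable G S → S v ≡ false → inCore v ≡ false
  inCore-false ms Sv = ≢true⇒≡false λ c → case trans (sym (inCore-sound c ms)) Sv of λ ()

  outsideCorona-false : ∀ {v S} → MaxStable G S → S v ≡ true → outsideCorona v ≡ false
  outsideCorona-false ms Sv = ≢true⇒≡false λ c → case trans (sym Sv) (outsideCorona-sound c ms) of λ ()

  outsideCorona-false⁻ : ∀ {v} → outsideCorona v ≡ false → ∃ λ S → MaxStable G S × S v ≡ true
  outsideCorona-false⁻ {v} e with S , S∈ , notSv ← all-false _ (Ω G) e =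
    S , ∈Ω⇒maxStable S∈ , not-injective notSv

α-cong : ∀ {n} {G H : Graph n} → (∀ i j → G i j ≡ H i j) → α G ≡ α H
α-cong {G = G} {H} G≗H with S , st , cardS ← maxStable-exists G | S′ , st′ , cardS′ ← maxStable-exists H =
  ≤-antisym (subst (_≤ α H) cardS (stable⇒card≤α H λ i j Si Sj → trans (sym (G≗H i j)) (st i j Si Sj)))
            (subst (_≤ α G) cardS′ (stable⇒card≤α G λ i j Si Sj → trans (G≗H i j) (st′ i j Si Sj)))

stable-insert : ∀ {n} {G : Graph n} {S v} → Simple G → Stable G S → (∀ j → S j ≡ true → G v j ≡ false) →
                Stable G (insert v S)
stable-insert {G = G} {S} {v} (sym-G , loopless) st v-free i j Si Sj with insert⁻ v S Si | insert⁻ v S Sj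
... | inj₁ refl | inj₁ refl = loopless i
... | inj₁ refl | inj₂ S′j  = v-free j S′j
... | inj₂ S′i  | inj₁ refl = trans (sym-G i j) (v-free i S′i)
... | inj₂ S′i  | inj₂ S′j  = st i j S′i S′j

maxStable-∋ : ∀ {n} {G : Graph n} {v S} → MaxStable G S → Stable G (insert v S) → S v ≡ true
maxStable-∋ {G = G} {v} {S} (st , card≡) st′ with S v in Sv
... | true  = refl
... | false = ⊥-elim (1+n≰n (begin
  suc (α G)         ≡⟨ cong suc (sym card≡) ⟩
  suc (card S)      ≡⟨ sym (card-insert v S Sv) ⟩
  card (insert v S) ≤⟨ stable⇒card≤α G st′ ⟩
  α G               ∎))
  where open ≤-Reasoning

isolated⇒∈maxStable : ∀ {n} {G : Graph n} {v S} → Simple G → (∀ j → G v j ≡ false) → MaxStable G S → S v ≡ true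
isolated⇒∈maxStable simple iso ms = maxStable-∋ ms (stable-insert simple (proj₁ ms) (λ j _ → iso j))

-- α-critical edges

module _ {n} (G : Graph n) (u v : Fin n) where

  deleteEdge-⊆ : ∀ {i j} → deleteEdge G (u , v) i j ≡ true → G i j ≡ true
  deleteEdge-⊆ = ∧-conicalˡ _ _

  deleteEdge-other : ∀ {i j} → i ≢ u → i ≢ v → deleteEdge G (u , v) i j ≡ G i j
  deleteEdge-other i≢u i≢v rewrite ≢⇒==false i≢u | ≢⇒==false i≢v = ∧-identityʳ _

  deleteEdge-removed : ∀ {i j} → deleteEdge G (u , v) i j ≡ false → G i j ≡ true →
                       (i ≡ u × j ≡ v) ⊎ (i ≡ v × j ≡ u)
  deleteEdge-removed {i} {j} e Gij rewrite Gij with i == u in iu | j == v in jv | i == v in iv | j == u in ju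
  ... | true  | true  | _     | _     = inj₁ (==⇒≡ iu , ==⇒≡ jv)
  ... | _     | _     | true  | true  = inj₂ (==⇒≡ iv , ==⇒≡ ju)
  ... | true  | false | true  | false with () ← e
  ... | true  | false | false | _     with () ← e
  ... | false | _     | true  | false with () ← e
  ... | false | _     | false | _     with () ← e

  stable-deleteEdge-lift : ∀ {S} → Stable (deleteEdge G (u , v)) S → S u ≡ false ⊎ S v ≡ false → Stable G S
  stable-deleteEdge-lift st missing i j Si Sj with G i j in Gij
  ... | false = refl
  ... | true with deleteEdge-removed (st i j Si Sj) Gij | missing
  ...   | inj₁ (refl , refl) | inj₁ Su = case trans (sym Si) Su of λ ()
  ...   | inj₁ (refl , refl) | inj₂ Sv = case trans (sym Sj) Sv of λ ()
  ...   | inj₂ (refl , refl) | inj₁ Su = case trans (sym Sj) Su of λ ()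
  ...   | inj₂ (refl , refl) | inj₂ Sv = case trans (sym Si) Sv of λ ()

  critical-intro : ∀ {S} → Stable (deleteEdge G (u , v)) S → α G < card S → isαCritical G (u , v) ≡ true
  critical-intro st α<card = Equivalence.to T-≡ (<⇒<ᵇ (≤-trans α<card (stable⇒card≤α _ st)))

  critical-elim : isαCritical G (u , v) ≡ true → ∃ λ S → Stable (deleteEdge G (u , v)) S × α G < card S
  critical-elim e with S , st , card≡ ← maxStable-exists (deleteEdge G (u , v)) =
    S , st , subst (α G <_) (sym card≡) (<ᵇ⇒< (α G) _ (Equivalence.from T-≡ e))

  critical-witness-∋ : ∀ {S} → Stable (deleteEdge G (u , v)) S → α G < card S → S u ≡ true × S v ≡ true
  critical-witness-∋ {S} st α<card with S u in Su | S v in Sv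
  ... | true  | true  = refl , refl
  ... | false | _     = ⊥-elim (<⇒≱ α<card (stable⇒card≤α G (stable-deleteEdge-lift st (inj₁ Su))))
  ... | true  | false = ⊥-elim (<⇒≱ α<card (stable⇒card≤α G (stable-deleteEdge-lift st (inj₂ Sv))))

  critical-witness-remove : ∀ {S} → Stable (deleteEdge G (u , v)) S → α G < card S → MaxStable G (remove u S)
  critical-witness-remove {S} st α<card =
    maxStable-intro G
      (stable-deleteEdge-lift (stable-remove _ u st) (inj₁ (remove-∌ u S)))
      (≤-pred (subst (α G <_) (card-remove u S (proj₁ (critical-witness-∋ st α<card))) α<card))

critical-swap : ∀ {n} (G : Graph n) u v → isαCritical G (u , v) ≡ isαCritical G (v , u)
critical-swap G u v = cong (α G <ᵇ_) (α-cong λ i j →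
  cong (λ b → G i j ∧ not b) (∨-comm (i == u ∧ j == v) (i == v ∧ j == u)))

allPairs : ∀ n → List (Edge n)
allPairs n = concatMap (λ i → map (i ,_) (allFin n)) (allFin n)

isEdge : ∀ {n} → Graph n → Edge n → Bool
isEdge G (i , j) = (toℕ i <ᵇ toℕ j) ∧ G i j

incident : ∀ {n} → Fin n → Edge n → Bool
incident p (i , j) = (i == p) ∨ (j == p)

isCriticalEdge : ∀ {n} → Graph n → Edge n → Bool
isCriticalEdge G e = isEdge G e ∧ isαCritical G e

edges-as-filter : ∀ {n} (G : Graph n) → edges G ≡ filter (isEdge G) (allPairs n)
edges-as-filter {n} G = sym (trans (filter-concatMap (isEdge G) _ (allFin n))
                                   (concatMap-cong (λ i → filter-map (isEdge G) (i ,_) (allFin n)) (allFin n)))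

η-as-count : ∀ {n} (G : Graph n) → η G ≡ count (isCriticalEdge G) (allPairs n)
η-as-count {n} G = trans (cong (count (isαCritical G)) (edges-as-filter G))
                         (count-filter (isαCritical G) (isEdge G) (allPairs n))

count-at-pair : ∀ {n} (g : Edge n → Bool) (a b : Fin n) →
                count (λ e → ((_== a) ⊗ (_== b)) e ∧ g e) (allPairs n) ≡ bit (g (a , b))
count-at-pair {n} g a b = trans (count-cong at-ab (allPairs n))
  (count-∧-const (g (a , b)) (allPairs n)
    (trans (count-⊗ (_== a) (_== b) (allFin n) (allFin n)) (cong₂ _*_ (count-single a) (count-single b))))
  where
  at-ab : ∀ e → ((_== a) ⊗ (_== b)) e ∧ g e ≡ ((_== a) ⊗ (_== b)) e ∧ g (a , b)
  at-ab (i , j) with i == a in ia | j == b in jb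
  ... | true  | true rewrite ==⇒≡ ia | ==⇒≡ jb = refl
  ... | true  | false = refl
  ... | false | _     = refl

∈-allPairs : ∀ {n} (i j : Fin n) → (i , j) ∈ allPairs n
∈-allPairs i j = ∈-concatMap⁺ _ (lose (∈-allFin i) (∈-map⁺ (i ,_) (∈-allFin j)))

∈-edges⁺ : ∀ {n} (G : Graph n) {i j} → (toℕ i <ᵇ toℕ j) ≡ true → G i j ≡ true → (i , j) ∈ edges G
∈-edges⁺ {n} G {i} {j} i<j Gij = subst ((i , j) ∈_) (sym (edges-as-filter G))
  (∈-filter⁺ (isEdge G) (allPairs n) (∈-allPairs i j) (trans (cong (_∧ G i j) i<j) Gij))

∈-edges⁻ : ∀ {n} (G : Graph n) {i j} → (i , j) ∈ edges G → G i j ≡ true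
∈-edges⁻ {n} G {i} {j} ij∈ =
  ∧-conicalʳ (toℕ i <ᵇ toℕ j) _ (proj₂ (∈-filter⁻ (isEdge G) (allPairs n) (subst ((i , j) ∈_) (edges-as-filter G) ij∈)))

∧-true : ∀ {a b} → a ≡ true → b ≡ true → a ∧ b ≡ true
∧-true refl refl = refl

∨-true⁻ : ∀ {a b} → a ∨ b ≡ true → a ≡ true ⊎ b ≡ true
∨-true⁻ {true}  _ = inj₁ refl
∨-true⁻ {false} e = inj₂ e

∨-trueˡ : ∀ {a b} → a ≡ true → a ∨ b ≡ true
∨-trueˡ refl = refl

∨-trueʳ : ∀ a {b} → b ≡ true → a ∨ b ≡ true
∨-trueʳ a refl = ∨-zeroʳ a

≡⇒== : ∀ {n} {i j : Fin n} → i ≡ j → (i == j) ≡ true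
≡⇒== {i = i} refl = ==-refl i

disjoint-incident : ∀ {n} (p : Fin n) e e′ → disjointEdges e e′ ≡ true → incident p e ≡ true → incident p e′ ≡ false
disjoint-incident p (a , b) (c , d) disj inc = ≢true⇒≡false λ inc′ →
  case trans (sym disj) (cong not (shared (∨-true⁻ inc) (∨-true⁻ inc′))) of λ ()
  where
  same : ∀ {x y} → (x == p) ≡ true → (y == p) ≡ true → (x == y) ≡ true
  same xp yp = ≡⇒== (trans (==⇒≡ xp) (sym (==⇒≡ yp)))
  shared : (a == p) ≡ true ⊎ (b == p) ≡ true → (c == p) ≡ true ⊎ (d == p) ≡ true →
           (a == c) ∨ (a == d) ∨ (b == c) ∨ (b == d) ≡ true
  shared (inj₁ ap) (inj₁ cp) = ∨-trueˡ (same ap cp)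
  shared (inj₁ ap) (inj₂ dp) = ∨-trueʳ (a == c) (∨-trueˡ (same ap dp))
  shared (inj₂ bp) (inj₁ cp) = ∨-trueʳ (a == c) (∨-trueʳ (a == d) (∨-trueˡ (same bp cp)))
  shared (inj₂ bp) (inj₂ dp) = ∨-trueʳ (a == c) (∨-trueʳ (a == d) (∨-trueʳ (b == c) (same bp dp)))

disjoint-≢ : ∀ {n} {a b c d : Fin n} → a ≢ c → a ≢ d → b ≢ c → b ≢ d → disjointEdges (a , b) (c , d) ≡ true
disjoint-≢ a≢c a≢d b≢c b≢d rewrite ≢⇒==false a≢c | ≢⇒==false a≢d | ≢⇒==false b≢c | ≢⇒==false b≢d = refl

matching-incident-≤1 : ∀ {n} (p : Fin n) M → isMatching M ≡ true → count (incident p) M ≤ 1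
matching-incident-≤1 p [] _ = z≤n
matching-incident-≤1 p (e ∷ M) isM with incident p e in inc
... | true  = s≤s (≤-reflexive (count-false′ M (∧-conicalˡ _ _ isM)))
  where
  count-false′ : ∀ M′ → all (disjointEdges e) M′ ≡ true → count (incident p) M′ ≡ 0
  count-false′ [] _ = refl
  count-false′ (e′ ∷ M′) disj rewrite disjoint-incident p e e′ (∧-conicalˡ _ _ disj) inc =
    count-false′ M′ (∧-conicalʳ (disjointEdges e e′) _ disj)
... | false = matching-incident-≤1 p M (∧-conicalʳ (all (disjointEdges e) M) _ isM)

isMatching-⊆ : ∀ {n} {ys xs : List (Edge n)} → ys ⊆ xs → isMatching xs ≡ true → isMatching ys ≡ true
isMatching-⊆ [] _ = refl
isMatching-⊆ {xs = x ∷ xs} (.x ∷ʳ τ) isM = isMatching-⊆ τ (∧-conicalʳ (all (disjointEdges x) xs) _ isM)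
isMatching-⊆ {xs = x ∷ xs} (refl ∷ τ) isM =
  ∧-true (all-⊆ (disjointEdges x) τ (∧-conicalˡ _ _ isM)) (isMatching-⊆ τ (∧-conicalʳ (all (disjointEdges x) xs) _ isM))

isMatching-insert : ∀ {n} (e : Edge n) ys₁ ys₂ → isMatching (ys₁ ++ ys₂) ≡ true →
                    (∀ y → y ∈ ys₁ ++ ys₂ → disjointEdges e y ≡ true × disjointEdges y e ≡ true) →
                    isMatching (ys₁ ++ e ∷ ys₂) ≡ true
isMatching-insert e [] ys₂ isM disj = ∧-true (all-intro _ ys₂ (λ y y∈ → proj₁ (disj y y∈))) isM
isMatching-insert e (y ∷ ys₁) ys₂ isM disj =
  ∧-true (all-intro (disjointEdges y) (ys₁ ++ e ∷ ys₂) (λ z z∈ → y-disjoint z (∈-++⁻ ys₁ z∈)))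
         (isMatching-insert e ys₁ ys₂ (∧-conicalʳ (all (disjointEdges y) (ys₁ ++ ys₂)) _ isM) (λ z z∈ → disj z (there z∈)))
  where
  y-disjoint : ∀ z → z ∈ ys₁ ⊎ z ∈ e ∷ ys₂ → disjointEdges y z ≡ true
  y-disjoint z (inj₁ z∈)         = all-elim _ (ys₁ ++ ys₂) (∧-conicalˡ _ _ isM) z (∈-++⁺ˡ z∈)
  y-disjoint z (inj₂ (here refl)) = proj₂ (disj y (here refl))
  y-disjoint z (inj₂ (there z∈)) = all-elim _ (ys₁ ++ ys₂) (∧-conicalˡ _ _ isM) z (∈-++⁺ʳ ys₁ z∈)

module _ {n} (G : Graph n) where

  matching⇒length≤μ : ∀ {M} → M ⊆ edges G → isMatching M ≡ true → length M ≤ μ G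
  matching⇒length≤μ M⊆ isM = maxℕ-ub _ (∈-map⁺ length (∈-filter⁺ isMatching _ (sublists-complete M⊆) isM))

  maxMatching-exists : ∃ λ M → M ⊆ edges G × isMatching M ≡ true × length M ≡ μ G
  maxMatching-exists with maxℕ-attained (map length (filter isMatching (sublists (edges G))))
  ... | inj₁ μ≡0 = [] , minimum (edges G) , refl , sym μ≡0
  ... | inj₂ μ∈ with M , M∈ , μ≡ ← ∈-map⁻ length μ∈ with M∈′ , isM ← ∈-filter⁻ isMatching (sublists (edges G)) M∈ =
    M , sublists-sound (edges G) M∈′ , isM , sym μ≡

-- Deleting the edges at the neighbour of a pendant vertex

isolate : ∀ {n} → Fin n → Graph n → Graph n
isolate p G i j = G i j ∧ not (incident p (i , j))

Pendant : ∀ {n} → Graph n → Fin n → Fin n → Set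
Pendant {n} G ℓ p = G ℓ p ≡ true × (∀ j → G ℓ j ≡ true → j ≡ p)

simple-isolate : ∀ {n} {G : Graph n} p → Simple G → Simple (isolate p G)
simple-isolate p (sym-G , loopless) =
  (λ i j → cong₂ _∧_ (sym-G i j) (cong not (∨-comm (i == p) (j == p)))) , (λ i → cong (_∧ _) (loopless i))

simple-deleteEdge : ∀ {n} {G : Graph n} u v → Simple G → Simple (deleteEdge G (u , v))
simple-deleteEdge u v (sym-G , loopless) =
  (λ i j → cong₂ _∧_ (sym-G i j) (cong not (trans (∨-comm (i == u ∧ j == v) _)
                                                   (cong₂ _∨_ (∧-comm (i == v) (j == u)) (∧-comm (i == u) (j == v)))))) ,
  (λ i → cong (_∧ _) (loopless i))

module _ {n} {G : Graph n} (p : Fin n) where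

  isolate-⊆ : ∀ {i j} → isolate p G i j ≡ true → G i j ≡ true × i ≢ p × j ≢ p
  isolate-⊆ {i} {j} e = ∧-conicalˡ _ _ e , ==false⇒≢ (∨-conicalˡ _ _ avoids-p) , ==false⇒≢ (∨-conicalʳ _ _ avoids-p)
    where
    avoids-p : incident p (i , j) ≡ false
    avoids-p = not-≡true (∧-conicalʳ (G i j) _ e)

  isolate-other : ∀ {i j} → i ≢ p → j ≢ p → isolate p G i j ≡ G i j
  isolate-other i≢p j≢p rewrite ≢⇒==false i≢p | ≢⇒==false j≢p = ∧-identityʳ _

  isolate-isolates : ∀ j → isolate p G p j ≡ false
  isolate-isolates j rewrite ==-refl p = ∧-zeroʳ (G p j)

  stable-isolate-insert : ∀ {S} → Simple G → Stable G S → Stable (isolate p G) (insert p S)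
  stable-isolate-insert simple st =
    stable-insert (simple-isolate p simple) (stable-subgraph G (proj₁ ∘ isolate-⊆) st) (λ j _ → isolate-isolates j)

  stable-remove-isolated : ∀ {S} → Stable (isolate p G) S → Stable G (remove p S)
  stable-remove-isolated {S} st i j Si Sj with remove⁻ p S Si | remove⁻ p S Sj
  ... | Si′ , i≢p | Sj′ , j≢p = trans (sym (isolate-other i≢p j≢p)) (st i j Si′ Sj′)

  edges-isolate : edges (isolate p G) ≡ filter (not ∘ incident p) (edges G)
  edges-isolate = begin
    edges (isolate p G)                                         ≡⟨ edges-as-filter (isolate p G) ⟩
    filter (isEdge (isolate p G)) (allPairs n)                  ≡⟨ filter-cong reassoc (allPairs n) ⟩
    filter (λ e → isEdge G e ∧ not (incident p e)) (allPairs n) ≡⟨ sym (filter-filter _ (isEdge G) (allPairs n)) ⟩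
    filter (not ∘ incident p) (filter (isEdge G) (allPairs n))  ≡⟨ cong (filter _) (sym (edges-as-filter G)) ⟩
    filter (not ∘ incident p) (edges G)                         ∎
    where
    open ≡-Reasoning
    reassoc : ∀ e → isEdge (isolate p G) e ≡ isEdge G e ∧ not (incident p e)
    reassoc (i , j) = sym (∧-assoc (toℕ i <ᵇ toℕ j) (G i j) _)

module PendantVertex {n} {G : Graph n} {ℓ p : Fin n} (simple : Simple G) (pendant : Pendant G ℓ p) where

  ℓ≢p : ℓ ≢ p
  ℓ≢p refl = case trans (sym (proj₁ pendant)) (proj₂ simple ℓ) of λ ()

  p≢ℓ : p ≢ ℓ
  p≢ℓ = ℓ≢p ∘ sym

  swap : VSet n → VSet n
  swap S = insert ℓ (remove p S)

  swap-∋ℓ : ∀ S → swap S ℓ ≡ true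
  swap-∋ℓ S = insert-∋ ℓ (remove p S)

  swap-∌p : ∀ S → swap S p ≡ false
  swap-∌p S = trans (insert-other ℓ (remove p S) p≢ℓ) (remove-∌ p S)

  swap-other : ∀ S {v} → v ≢ ℓ → v ≢ p → swap S v ≡ S v
  swap-other S v≢ℓ v≢p = trans (insert-other ℓ (remove p S) v≢ℓ) (remove-other p S v≢p)

  stable-∌ℓ : ∀ {S} → Stable G S → S p ≡ true → S ℓ ≡ false
  stable-∌ℓ st Sp = ≢true⇒≡false λ Sℓ → case trans (sym (proj₁ pendant)) (st ℓ p Sℓ Sp) of λ ()

  stable-insert-pendant : ∀ {S} → Stable G S → S p ≡ false → Stable G (insert ℓ S)
  stable-insert-pendant {S} st Sp = stable-insert simple st λ j Sj → ≢true⇒≡false λ Gℓj →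
    case trans (sym (subst (λ k → S k ≡ true) (proj₂ pendant j Gℓj) Sj)) Sp of λ ()

  stable-swap : ∀ {S} → Stable G S → Stable G (swap S)
  stable-swap {S} st = stable-insert-pendant (stable-remove G p st) (remove-∌ p S)

  maxStable-swap : ∀ {S} → MaxStable G S → MaxStable G (swap S)
  maxStable-swap {S} (st , card≡) =
    maxStable-intro G (stable-swap st) (subst (_≤ card (swap S)) card≡ (card-≤-swap S ℓ≢p (stable-∌ℓ st)))

  lift : VSet n → VSet n
  lift S = insert p (swap S)

  lift-other : ∀ S {v} → v ≢ ℓ → v ≢ p → lift S v ≡ S v
  lift-other S v≢ℓ v≢p = trans (insert-other p (swap S) v≢p) (swap-other S v≢ℓ v≢p)

  stable-lift : ∀ {S} → Stable G S → Stable (isolate p G) (lift S)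
  stable-lift st = stable-isolate-insert p simple (stable-swap st)

  card-lift : ∀ {S} → MaxStable G S → card (lift S) ≡ suc (α G)
  card-lift {S} ms = trans (card-insert p (swap S) (swap-∌p S)) (cong suc (proj₂ (maxStable-swap ms)))

  α-isolate : α (isolate p G) ≡ suc (α G)
  α-isolate with S , ms ← maxStable-exists G | S′ , st′ , card≡′ ← maxStable-exists (isolate p G) =
    ≤-antisym upper lower
    where
    open ≤-Reasoning
    upper : α (isolate p G) ≤ suc (α G)
    upper = begin
      α (isolate p G)          ≡⟨ sym card≡′ ⟩
      card S′                  ≤⟨ card-≤-remove p S′ ⟩
      suc (card (remove p S′)) ≤⟨ s≤s (stable⇒card≤α G (stable-remove-isolated p st′)) ⟩
      suc (α G)                ∎
    lower : suc (α G) ≤ α (isolate p G)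
    lower = begin
      suc (α G)                ≡⟨ sym (card-lift ms) ⟩
      card (lift S)            ≤⟨ stable⇒card≤α _ (stable-lift (proj₁ ms)) ⟩
      α (isolate p G)          ∎

module PendantReduction {n} {F : Graph n} {ℓ p : Fin n} (simple : Simple F) (pendant : Pendant F ℓ p) where

  open PendantVertex simple pendant public

  F′ : Graph n
  F′ = isolate p F

  simple′ : Simple F′
  simple′ = simple-isolate p simple

  ℓ-isolated′ : ∀ j → F′ ℓ j ≡ false
  ℓ-isolated′ j with F ℓ j in Fℓj
  ... | false = refl
  ... | true with refl ← proj₂ pendant j Fℓj = cong not (trans (cong ((ℓ == p) ∨_) (==-refl p)) (∨-zeroʳ (ℓ == p)))

  p-isolated′ : ∀ j → F′ p j ≡ false
  p-isolated′ = isolate-isolates {G = F} p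

  Touches : Fin n → Fin n → Set
  Touches i j = i ≡ ℓ ⊎ i ≡ p ⊎ j ≡ ℓ ⊎ j ≡ p

  PendantPair : Fin n → Fin n → Set
  PendantPair i j = (i ≡ ℓ × j ≡ p) ⊎ (i ≡ p × j ≡ ℓ)

  touches? : ∀ i j → Touches i j ⊎ (i ≢ ℓ × i ≢ p × j ≢ ℓ × j ≢ p)
  touches? i j with i ≟ ℓ | i ≟ p | j ≟ ℓ | j ≟ p
  ... | yes e | _     | _     | _     = inj₁ (inj₁ e)
  ... | no _  | yes e | _     | _     = inj₁ (inj₂ (inj₁ e))
  ... | no _  | no _  | yes e | _     = inj₁ (inj₂ (inj₂ (inj₁ e)))
  ... | no _  | no _  | no _  | yes e = inj₁ (inj₂ (inj₂ (inj₂ e)))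
  ... | no a  | no b  | no c  | no d  = inj₂ (a , b , c , d)

  F′-touching : ∀ {i j} → Touches i j → F′ i j ≡ false
  F′-touching {j = j} (inj₁ refl)                = ℓ-isolated′ j
  F′-touching {j = j} (inj₂ (inj₁ refl))         = p-isolated′ j
  F′-touching {i = i} (inj₂ (inj₂ (inj₁ refl)))  = trans (proj₁ simple′ i ℓ) (ℓ-isolated′ i)
  F′-touching {i = i} (inj₂ (inj₂ (inj₂ refl)))  = trans (proj₁ simple′ i p) (p-isolated′ i)

  F′-edge-away : ∀ {c d} → F′ c d ≡ true → c ≢ ℓ × c ≢ p × d ≢ ℓ × d ≢ p
  F′-edge-away e = (λ c≡ℓ → absurd (inj₁ c≡ℓ)) , (λ c≡p → absurd (inj₂ (inj₁ c≡p))) ,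
                   (λ d≡ℓ → absurd (inj₂ (inj₂ (inj₁ d≡ℓ)))) , (λ d≡p → absurd (inj₂ (inj₂ (inj₂ d≡p))))
    where
    absurd : ∀ {A : Set} → Touches _ _ → A
    absurd t = case trans (sym e) (F′-touching t) of λ ()

  pendantPair⇒touches : ∀ {a b} → PendantPair a b → Touches a b
  pendantPair⇒touches (inj₁ (a≡ℓ , _)) = inj₁ a≡ℓ
  pendantPair⇒touches (inj₂ (a≡p , _)) = inj₂ (inj₁ a≡p)

  pendantPair-disjoint : ∀ {a b c d} → PendantPair a b → F′ c d ≡ true →
                         disjointEdges (a , b) (c , d) ≡ true × disjointEdges (c , d) (a , b) ≡ true
  pendantPair-disjoint ab e with c≢ℓ , c≢p , d≢ℓ , d≢p ← F′-edge-away e | ab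
  ... | inj₁ (refl , refl) = disjoint-≢ (c≢ℓ ∘ sym) (d≢ℓ ∘ sym) (c≢p ∘ sym) (d≢p ∘ sym) , disjoint-≢ c≢ℓ c≢p d≢ℓ d≢p
  ... | inj₂ (refl , refl) = disjoint-≢ (c≢p ∘ sym) (d≢p ∘ sym) (c≢ℓ ∘ sym) (d≢ℓ ∘ sym) , disjoint-≢ c≢p c≢ℓ d≢p d≢ℓ

  pendantPair-edge : ∀ {a b} → PendantPair a b → F a b ≡ true
  pendantPair-edge (inj₁ (refl , refl)) = proj₁ pendant
  pendantPair-edge (inj₂ (refl , refl)) = trans (proj₁ simple p ℓ) (proj₁ pendant)

  pendantPair-incident : ∀ {a b} → PendantPair a b → incident p (a , b) ≡ true
  pendantPair-incident (inj₁ (refl , refl)) = ∨-trueʳ (ℓ == p) (==-refl p)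
  pendantPair-incident (inj₂ (refl , refl)) rewrite ==-refl p = refl

  -- edges lists the pendant edge only in this orientation.
  pendantEdge-oriented : ∃₂ λ a b → (toℕ a <ᵇ toℕ b) ≡ true × PendantPair a b
  pendantEdge-oriented with <-cmp (toℕ ℓ) (toℕ p)
  ... | tri< ℓ<p _ _ = ℓ , p , Equivalence.to T-≡ (<⇒<ᵇ ℓ<p) , inj₁ (refl , refl)
  ... | tri≈ _ ℓ≡p _ = ⊥-elim (ℓ≢p (toℕ-injective ℓ≡p))
  ... | tri> _ _ p<ℓ = p , ℓ , Equivalence.to T-≡ (<⇒<ᵇ p<ℓ) , inj₂ (refl , refl)

  oriented-unique : ∀ {a b i j} → (toℕ a <ᵇ toℕ b) ≡ true → PendantPair a b →
                    (toℕ i <ᵇ toℕ j) ≡ true → PendantPair i j → i ≡ a × j ≡ b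
  oriented-unique _   (inj₁ (refl , refl)) _   (inj₁ (refl , refl)) = refl , refl
  oriented-unique _   (inj₂ (refl , refl)) _   (inj₂ (refl , refl)) = refl , refl
  oriented-unique ℓ<p (inj₁ (refl , refl)) p<ℓ (inj₂ (refl , refl)) =
    ⊥-elim (<-asym (<ᵇ⇒< (toℕ ℓ) (toℕ p) (Equivalence.from T-≡ ℓ<p)) (<ᵇ⇒< (toℕ p) (toℕ ℓ) (Equivalence.from T-≡ p<ℓ)))
  oriented-unique p<ℓ (inj₂ (refl , refl)) ℓ<p (inj₁ (refl , refl)) =
    ⊥-elim (<-asym (<ᵇ⇒< (toℕ ℓ) (toℕ p) (Equivalence.from T-≡ ℓ<p)) (<ᵇ⇒< (toℕ p) (toℕ ℓ) (Equivalence.from T-≡ p<ℓ)))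

  maxStable-lift : ∀ {S} → MaxStable F S → MaxStable F′ (lift S)
  maxStable-lift ms = maxStable-intro F′ (stable-lift (proj₁ ms)) (≤-reflexive (trans α-isolate (sym (card-lift ms))))

  maxStable-lower : ∀ {S′} → MaxStable F′ S′ → MaxStable F (remove p S′)
  maxStable-lower {S′} ms′@(st′ , card≡′) = stable-remove-isolated p st′ , suc-injective (begin
    suc (card (remove p S′)) ≡⟨ sym (card-remove p S′ (isolated⇒∈maxStable simple′ p-isolated′ ms′)) ⟩
    card S′                  ≡⟨ card≡′ ⟩
    α F′                     ≡⟨ α-isolate ⟩
    suc (α F)                ∎)
    where open ≡-Reasoning

  inCore-away : ∀ {v} → v ≢ ℓ → v ≢ p → inCore F v ≡ inCore F′ v
  inCore-away v≢ℓ v≢p = bool-ext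
    (λ c → inCore-complete F′ λ S′ ms′ → proj₁ (remove⁻ p S′ (inCore-sound F c (maxStable-lower ms′))))
    (λ c → inCore-complete F λ S ms → trans (sym (lift-other S v≢ℓ v≢p)) (inCore-sound F′ c (maxStable-lift ms)))

  outsideCorona-away : ∀ {v} → v ≢ ℓ → v ≢ p → outsideCorona F v ≡ outsideCorona F′ v
  outsideCorona-away v≢ℓ v≢p = bool-ext
    (λ c → outsideCorona-complete F′ λ S′ ms′ →
             trans (sym (remove-other p S′ v≢p)) (outsideCorona-sound F c (maxStable-lower ms′)))
    (λ c → outsideCorona-complete F λ S ms →
             trans (sym (lift-other S v≢ℓ v≢p)) (outsideCorona-sound F′ c (maxStable-lift ms)))

  inCore′-ℓ : inCore F′ ℓ ≡ true
  inCore′-ℓ = inCore-complete F′ λ _ → isolated⇒∈maxStable simple′ ℓ-isolated′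

  inCore′-p : inCore F′ p ≡ true
  inCore′-p = inCore-complete F′ λ _ → isolated⇒∈maxStable simple′ p-isolated′

  outsideCorona′-ℓ : outsideCorona F′ ℓ ≡ false
  outsideCorona′-ℓ with _ , ms ← maxStable-exists F′ =
    outsideCorona-false F′ ms (isolated⇒∈maxStable simple′ ℓ-isolated′ ms)

  outsideCorona′-p : outsideCorona F′ p ≡ false
  outsideCorona′-p with _ , ms ← maxStable-exists F′ =
    outsideCorona-false F′ ms (isolated⇒∈maxStable simple′ p-isolated′ ms)

  inCore-p : inCore F p ≡ false
  inCore-p with S , ms ← maxStable-exists F = inCore-false F (maxStable-swap ms) (swap-∌p S)

  outsideCorona-ℓ : outsideCorona F ℓ ≡ false
  outsideCorona-ℓ with S , ms ← maxStable-exists F = outsideCorona-false F (maxStable-swap ms) (swap-∋ℓ S)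

  -- Both say that no maximum stable set contains p: a maximum stable set avoiding p can take ℓ.
  inCore-ℓ : inCore F ℓ ≡ outsideCorona F p
  inCore-ℓ = bool-ext
    (λ c → outsideCorona-complete F λ S ms → ≢true⇒≡false λ Sp →
             case trans (sym (inCore-sound F c ms)) (stable-∌ℓ (proj₁ ms) Sp) of λ ())
    (λ c → inCore-complete F λ S ms → maxStable-∋ ms (stable-insert-pendant (proj₁ ms) (outsideCorona-sound F c ms)))

  ξ-step : ξ F + 2 ≡ ξ F′ + bit (outsideCorona F p)
  ξ-step with count-agree-at₂ {f = inCore F} {g = inCore F′} ℓ≢p (λ v → inCore-away)
  ... | agree rewrite inCore′-ℓ | inCore′-p | inCore-ℓ | inCore-p = trans agree (cong (ξ F′ +_) (+-identityʳ _))

  σ-step : σ F ≡ σ F′ + bit (outsideCorona F p)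
  σ-step with count-agree-at₂ {f = outsideCorona F} {g = outsideCorona F′} ℓ≢p (λ v → outsideCorona-away)
  ... | agree rewrite outsideCorona′-ℓ | outsideCorona′-p | outsideCorona-ℓ = trans (sym (+-identityʳ _)) agree

  ℓ-isolated-after-deleteEdge : ∀ j → deleteEdge F (ℓ , p) ℓ j ≡ false
  ℓ-isolated-after-deleteEdge j with F ℓ j in Fℓj
  ... | false = refl
  ... | true with refl ← proj₂ pendant j Fℓj rewrite ==-refl ℓ | ==-refl p = refl

  critical-pendantEdge : isαCritical F (ℓ , p) ≡ not (outsideCorona F p)
  critical-pendantEdge = bool-ext critical⇒p∈maxStable p∈maxStable⇒critical
    where
    critical⇒p∈maxStable : isαCritical F (ℓ , p) ≡ true → not (outsideCorona F p) ≡ true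
    critical⇒p∈maxStable e with S , st , α<card ← critical-elim F ℓ p e =
      cong not (outsideCorona-false F (critical-witness-remove F ℓ p st α<card)
                                      (trans (remove-other ℓ S p≢ℓ) (proj₂ (critical-witness-∋ F ℓ p st α<card))))
    p∈maxStable⇒critical : not (outsideCorona F p) ≡ true → isαCritical F (ℓ , p) ≡ true
    p∈maxStable⇒critical e with S , ms , Sp ← outsideCorona-false⁻ F (not-≡true e) =
      critical-intro F ℓ p
        (stable-insert (simple-deleteEdge ℓ p simple) (stable-subgraph F (deleteEdge-⊆ F ℓ p) (proj₁ ms))
                       (λ j _ → ℓ-isolated-after-deleteEdge j))
        (≤-reflexive (sym (trans (card-insert ℓ S (stable-∌ℓ (proj₁ ms) Sp)) (cong suc (proj₂ ms)))))

  -- A witness set contains p but not ℓ (ℓp survives in F − pw), so swapping p for ℓ in it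
  -- gives a stable set of F that is too large.
  critical-at-p : ∀ {w} → w ≢ ℓ → isαCritical F (p , w) ≡ false
  critical-at-p {w} w≢ℓ = ≢true⇒≡false λ e → too-large (critical-elim F p w e)
    where
    too-large : ¬ (∃ λ S → Stable (deleteEdge F (p , w)) S × α F < card S)
    too-large (S , st , α<card) = <⇒≱ α<card (begin
      card S        ≤⟨ card-≤-swap S ℓ≢p (λ _ → Sℓ) ⟩
      card (swap S) ≤⟨ stable⇒card≤α F (stable-insert-pendant stF (remove-∌ p S)) ⟩
      α F           ∎)
      where
      open ≤-Reasoning
      Sp : S p ≡ true
      Sp = proj₁ (critical-witness-∋ F p w st α<card)
      Sℓ : S ℓ ≡ false
      Sℓ = ≢true⇒≡false λ Sℓ → case trans (sym (trans (deleteEdge-other F p w ℓ≢p (w≢ℓ ∘ sym)) (proj₁ pendant)))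
                                          (st ℓ p Sℓ Sp) of λ ()
      stF : Stable F (remove p S)
      stF = stable-deleteEdge-lift F p w (stable-remove _ p st) (inj₁ (remove-∌ p S))

  critical-away : ∀ {u v} → u ≢ ℓ → u ≢ p → v ≢ ℓ → v ≢ p → isαCritical F′ (u , v) ≡ isαCritical F (u , v)
  critical-away {u} {v} u≢ℓ u≢p v≢ℓ v≢p =
    cong₂ _<ᵇ_ α-isolate (trans (α-cong reorder) (PendantVertex.α-isolate (simple-deleteEdge u v simple) pendant−uv))
    where
    pendant−uv : Pendant (deleteEdge F (u , v)) ℓ p
    pendant−uv = trans (deleteEdge-other F u v (u≢ℓ ∘ sym) (v≢ℓ ∘ sym)) (proj₁ pendant) ,
                 λ j e → proj₂ pendant j (deleteEdge-⊆ F u v e)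
    reorder : ∀ i j → deleteEdge F′ (u , v) i j ≡ isolate p (deleteEdge F (u , v)) i j
    reorder i j = trans (∧-assoc (F i j) _ _)
                        (trans (cong (F i j ∧_) (∧-comm (not (incident p (i , j))) _)) (sym (∧-assoc (F i j) _ _)))

  critical-from-p : ∀ {j} → isαCritical F (p , j) ≡ true → j ≡ ℓ
  critical-from-p {j} crit with j ≟ ℓ
  ... | yes j≡ℓ = j≡ℓ
  ... | no  j≢ℓ = case trans (sym crit) (critical-at-p j≢ℓ) of λ ()

  critical-touching : ∀ {i j} → F i j ≡ true → isαCritical F (i , j) ≡ true → Touches i j → PendantPair i j
  critical-touching {j = j} Fij _    (inj₁ refl)               = inj₁ (refl , proj₂ pendant j Fij)
  critical-touching         _   crit (inj₂ (inj₁ refl))        = inj₂ (refl , critical-from-p crit)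
  critical-touching {i = i} Fij _    (inj₂ (inj₂ (inj₁ refl))) = inj₂ (proj₂ pendant i (trans (proj₁ simple ℓ i) Fij) , refl)
  critical-touching {i = i} _   crit (inj₂ (inj₂ (inj₂ refl))) =
    inj₁ (critical-from-p (trans (critical-swap F p i) crit) , refl)

  isCriticalEdge-off : ∀ {a b} → (toℕ a <ᵇ toℕ b) ≡ true → PendantPair a b →
                       ∀ i j → ¬ (i ≡ a × j ≡ b) → isCriticalEdge F (i , j) ≡ isCriticalEdge F′ (i , j)
  isCriticalEdge-off a<b ab i j ≢ab with touches? i j
  ... | inj₂ (i≢ℓ , i≢p , j≢ℓ , j≢p)
    rewrite isolate-other {G = F} p i≢p j≢p | critical-away i≢ℓ i≢p j≢ℓ j≢p = refl
  ... | inj₁ t rewrite F′-touching t | ∧-zeroʳ (toℕ i <ᵇ toℕ j) = ≢true⇒≡false λ h →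
    ≢ab (oriented-unique a<b ab (∧-conicalˡ _ _ (∧-conicalˡ _ _ h))
                                (critical-touching (∧-conicalʳ (toℕ i <ᵇ toℕ j) _ (∧-conicalˡ _ _ h)) (∧-conicalʳ _ _ h) t))

  isCriticalEdge-pendant : ∀ {a b} → (toℕ a <ᵇ toℕ b) ≡ true → PendantPair a b →
                           isCriticalEdge F (a , b) ≡ not (outsideCorona F p)
  isCriticalEdge-pendant a<b (inj₁ (refl , refl)) rewrite a<b | proj₁ pendant = critical-pendantEdge
  isCriticalEdge-pendant a<b (inj₂ (refl , refl)) rewrite a<b | proj₁ simple p ℓ | proj₁ pendant =
    trans (critical-swap F p ℓ) critical-pendantEdge

  isCriticalEdge′-pendant : ∀ {a b} → PendantPair a b → isCriticalEdge F′ (a , b) ≡ false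
  isCriticalEdge′-pendant {a} {b} ab rewrite F′-touching (pendantPair⇒touches ab) | ∧-zeroʳ (toℕ a <ᵇ toℕ b) = refl

  η-step : η F ≡ η F′ + bit (not (outsideCorona F p))
  η-step with a , b , a<b , ab ← pendantEdge-oriented = begin
    η F                                                ≡⟨ η-as-count F ⟩
    count (isCriticalEdge F) pairs                     ≡⟨ sym (+-identityʳ _) ⟩
    count (isCriticalEdge F) pairs + bit false
      ≡⟨ cong (λ c → count _ pairs + bit c) (sym (isCriticalEdge′-pendant ab)) ⟩
    count (isCriticalEdge F) pairs + bit (isCriticalEdge F′ (a , b))
      ≡⟨ cong (count _ pairs +_) (sym (count-at-pair (isCriticalEdge F′) a b)) ⟩
    count (isCriticalEdge F) pairs + count (λ e → at-ab e ∧ isCriticalEdge F′ e) pairs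
      ≡⟨ count-agree off pairs ⟩
    count (isCriticalEdge F′) pairs + count (λ e → at-ab e ∧ isCriticalEdge F e) pairs
      ≡⟨ cong₂ _+_ (sym (η-as-count F′)) (count-at-pair (isCriticalEdge F) a b) ⟩
    η F′ + bit (isCriticalEdge F (a , b))              ≡⟨ cong (λ c → η F′ + bit c) (isCriticalEdge-pendant a<b ab) ⟩
    η F′ + bit (not (outsideCorona F p))               ∎
    where
    open ≡-Reasoning
    pairs : List (Edge n)
    pairs = allPairs n
    at-ab : Edge n → Bool
    at-ab = (_== a) ⊗ (_== b)
    off : ∀ e → at-ab e ≡ false → isCriticalEdge F e ≡ isCriticalEdge F′ e
    off (i , j) e = isCriticalEdge-off a<b ab i j λ { (refl , refl) →
      case trans (sym e) (cong₂ _∧_ (==-refl a) (==-refl b)) of λ () }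

  μ-step : μ F ≡ suc (μ F′)
  μ-step = ≤-antisym at-most at-least
    where
    q : Edge n → Bool
    q = not ∘ incident p

    at-most : μ F ≤ suc (μ F′)
    at-most with M , M⊆ , isM , len ← maxMatching-exists F = begin
      μ F                                     ≡⟨ sym len ⟩
      length M                                ≡⟨ length-filter q M ⟩
      length (filter q M) + count (not ∘ q) M ≤⟨ +-mono-≤ (matching⇒length≤μ F′ filter⊆ (isMatching-⊆ (filter-⊆ q M) isM))
                                                          (subst (_≤ 1) (count-cong (λ e → sym (not-involutive _)) M)
                                                                 (matching-incident-≤1 p M isM)) ⟩
      μ F′ + 1                                ≡⟨ +-comm (μ F′) 1 ⟩
      suc (μ F′)                              ∎
      where
      open ≤-Reasoning
      filter⊆ : filter q M ⊆ edges F′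
      filter⊆ = subst (filter q M ⊆_) (sym (edges-isolate p)) (filter-mono-⊆ q M⊆)

    at-least : suc (μ F′) ≤ μ F
    at-least with a , b , a<b , ab ← pendantEdge-oriented | M′ , M′⊆ , isM′ , len′ ← maxMatching-exists F′
      with ys₁ , ys₂ , ys≡ , τ ← ⊆-filter-insert q (edges F) (subst (M′ ⊆_) (edges-isolate p) M′⊆)
                                   (∈-edges⁺ F a<b (pendantPair-edge ab)) (cong not (pendantPair-incident ab)) =
      subst (_≤ μ F) length≡ (matching⇒length≤μ F τ (isMatching-insert (a , b) ys₁ ys₂ isM disjoint))
      where
      isM : isMatching (ys₁ ++ ys₂) ≡ true
      isM = subst (λ M → isMatching M ≡ true) (sym ys≡) isM′
      disjoint : ∀ y → y ∈ ys₁ ++ ys₂ → disjointEdges (a , b) y ≡ true × disjointEdges y (a , b) ≡ true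
      disjoint (c , d) y∈ = pendantPair-disjoint ab (∈-edges⁻ F′ (lookup M′⊆ (subst ((c , d) ∈_) ys≡ y∈)))
      length≡ : length (ys₁ ++ (a , b) ∷ ys₂) ≡ suc (μ F′)
      length≡ = begin
        length (ys₁ ++ (a , b) ∷ ys₂)       ≡⟨ length-++ ys₁ ⟩
        length ys₁ + suc (length ys₂)       ≡⟨ +-suc (length ys₁) _ ⟩
        suc (length ys₁ + length ys₂)       ≡⟨ cong suc (sym (length-++ ys₁)) ⟩
        suc (length (ys₁ ++ ys₂))           ≡⟨ cong (suc ∘ length) ys≡ ⟩
        suc (length M′)                     ≡⟨ cong suc len′ ⟩
        suc (μ F′)                          ∎
        where open ≡-Reasoning

  fewer-edges : length (edges F′) < length (edges F)
  fewer-edges with a , b , a<b , ab ← pendantEdge-oriented = begin-strict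
    length (edges F′)                                      ≡⟨ cong length (edges-isolate p) ⟩
    length (filter q (edges F))
      <⟨ m<m+n _ (count-≥1 (edges F) ab∈ (trans (not-involutive _) (pendantPair-incident ab))) ⟩
    length (filter q (edges F)) + count (not ∘ q) (edges F) ≡⟨ sym (length-filter q (edges F)) ⟩
    length (edges F)                                       ∎
    where
    open ≤-Reasoning
    q : Edge n → Bool
    q = not ∘ incident p
    ab∈ : (a , b) ∈ edges F
    ab∈ = ∈-edges⁺ F a<b (pendantPair-edge ab)

-- Forests

module _ {A : Set} {R : A → A → Set} where

  AllPairs-++⁻ˡ : ∀ xs {ys} → AllPairs R (xs ++ ys) → AllPairs R xs
  AllPairs-++⁻ˡ []       _           = []
  AllPairs-++⁻ˡ (x ∷ xs) (px ∷ pxs) = All.++⁻ˡ xs px ∷ AllPairs-++⁻ˡ xs pxs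

  Linked-++⁻ˡ : ∀ xs {ys} → Linked R (xs ++ ys) → Linked R xs
  Linked-++⁻ˡ []           _       = []
  Linked-++⁻ˡ (x ∷ [])     _       = [-]
  Linked-++⁻ˡ (x ∷ y ∷ xs) (r ∷ l) = r ∷ Linked-++⁻ˡ (y ∷ xs) l

  Linked-snoc : ∀ xs {y z} → Linked R (xs ++ [ y ]) → R y z → Linked R ((xs ++ [ y ]) ++ [ z ])
  Linked-snoc []           _        r = r ∷ [-]
  Linked-snoc (x ∷ [])     (r′ ∷ _) r = r′ ∷ r ∷ [-]
  Linked-snoc (x ∷ y ∷ xs) (r′ ∷ l) r = r′ ∷ Linked-snoc (y ∷ xs) l r

listSet : ∀ {n} → List (Fin n) → VSet n
listSet []       _ = false
listSet (x ∷ xs)   = insert x (listSet xs)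

unique⇒length≤ : ∀ {n} (xs : List (Fin n)) → Unique xs → length xs ≤ n
unique⇒length≤ {n} xs u = subst (_≤ _) (card-listSet xs u) (card-≤ (listSet xs))
  where
  listSet-∌ : ∀ {x} ys → All (x ≢_) ys → listSet ys x ≡ false
  listSet-∌ []       []          = refl
  listSet-∌ (y ∷ ys) (x≢y ∷ x∉) = trans (insert-other y (listSet ys) x≢y) (listSet-∌ ys x∉)
  card-listSet : ∀ ys → Unique ys → card (listSet ys) ≡ length ys
  card-listSet []       []         = count-false (λ _ → refl) (allFin n)
  card-listSet (y ∷ ys) (y∉ ∷ u′) = trans (card-insert y (listSet ys) (listSet-∌ ys y∉)) (cong suc (card-listSet ys u′))

module _ {n} {G : Graph n} (simple : Simple G) (acyclic : Acyclic G) where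

  Adjacent : Fin n → Fin n → Set
  Adjacent i j = G i j ≡ true

  Path : List (Fin n) → Set
  Path vs = Unique vs × Linked Adjacent vs

  -- Otherwise the path c ∷ ⋯ ∷ j and the edge jc form a cycle.
  path-no-return : ∀ {c pr rest j} → Path (c ∷ pr ∷ rest) → G c j ≡ true → j ≢ pr → ¬ (j ∈ c ∷ pr ∷ rest)
  path-no-return {c} _ Gcj _ (here refl) = case trans (sym Gcj) (proj₂ simple c) of λ ()
  path-no-return {c} {pr} {rest} {j} (u , lk) Gcj j≢pr (there j∈) with ∈-∃++ j∈
  ... | [] , suf , eq = j≢pr (sym (∷-injectiveˡ eq))
  ... | y ∷ pre , suf , eq = acyclic (c , (y ∷ pre) ++ [ j ] , length≥2 , unique , linked)
    where
    split : c ∷ pr ∷ rest ≡ ((c ∷ y ∷ pre) ++ [ j ]) ++ suf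
    split = cong (c ∷_) (trans eq (sym (++-assoc (y ∷ pre) [ j ] suf)))
    length≥2 : 2 ≤ length ((y ∷ pre) ++ [ j ])
    length≥2 = s≤s (subst (1 ≤_) (sym (length-++ pre)) (m≤n+m 1 (length pre)))
    unique : Unique (c ∷ (y ∷ pre) ++ [ j ])
    unique = AllPairs-++⁻ˡ ((c ∷ y ∷ pre) ++ [ j ]) (subst Unique split u)
    linked : Linked Adjacent ((c ∷ (y ∷ pre) ++ [ j ]) ++ [ c ])
    linked = Linked-snoc (c ∷ y ∷ pre) (Linked-++⁻ˡ ((c ∷ y ∷ pre) ++ [ j ]) (subst (Linked Adjacent) split lk))
                       (trans (proj₁ simple j c) Gcj)

  -- Extend a path at its end c for as long as c has a neighbour other than its predecessor;
  -- paths have at most n vertices, so this stops, and it stops at a pendant vertex.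
  extend : ∀ fuel c pr rest → Path (c ∷ pr ∷ rest) → n < length (c ∷ pr ∷ rest) + fuel → ∃₂ (Pendant G)
  extend zero c pr rest (u , _) bound = ⊥-elim (<⇒≱ (subst (n <_) (+-identityʳ _) bound) (unique⇒length≤ _ u))
  extend (suc fuel) c pr rest path@(u , lk@(Gcpr ∷ _)) bound
    with any? (λ j → (G c j ≟ᵇ true) ×-dec ¬? (j ≟ pr))
  ... | yes (j , Gcj , j≢pr) =
    extend fuel j c (pr ∷ rest)
      (All.¬Any⇒All¬ _ (path-no-return path Gcj j≢pr) ∷ u , trans (proj₁ simple j c) Gcj ∷ lk)
      (subst (n <_) (+-suc (length (c ∷ pr ∷ rest)) fuel) bound)
  ... | no no-other = c , pr , Gcpr , only-pr
    where
    only-pr : ∀ j → G c j ≡ true → j ≡ pr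
    only-pr j Gcj with j ≟ pr
    ... | yes j≡pr = j≡pr
    ... | no  j≢pr = ⊥-elim (no-other (j , Gcj , j≢pr))

  pendant-exists : ∀ {u v} → G u v ≡ true → ∃₂ (Pendant G)
  pendant-exists {u} {v} Guv =
    extend n v u [] ((v≢u ∷ []) ∷ [] ∷ [] , trans (proj₁ simple v u) Guv ∷ [-]) (s≤s (m≤n+m n 1))
    where
    v≢u : v ≢ u
    v≢u refl = case trans (sym Guv) (proj₂ simple u) of λ ()

ForestIdentities : ∀ {n} → Graph n → Set
ForestIdentities {n} G = (ξ G + η G ≡ α G) × (σ G + η G ≡ μ G) × (α G + μ G ≡ n)

bit-not : ∀ c → bit c + bit (not c) ≡ 1
bit-not true  = refl
bit-not false = refl

interchange : ∀ a b c d → (a + b) + (c + d) ≡ (a + c) + (b + d)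
interchange = solve-∀

identities-step : ∀ {n} {F : Graph n} {ℓ p} → Simple F → Pendant F ℓ p →
                  ForestIdentities (isolate p F) → ForestIdentities F
identities-step {n} {F} {p = p} simple pendant (ξ+η′ , σ+η′ , α+μ′) = ξ+η , σ+η , α+μ
  where
  open PendantReduction simple pendant
  open ≡-Reasoning
  c : Bool
  c = outsideCorona F p
  ξ+η : ξ F + η F ≡ α F
  ξ+η = +-cancelʳ-≡ 2 _ _ (begin
    ξ F + η F + 2                               ≡⟨ +-comm-swap (ξ F) (η F) 2 ⟩
    (ξ F + 2) + η F                             ≡⟨ cong₂ _+_ ξ-step η-step ⟩
    (ξ F′ + bit c) + (η F′ + bit (not c))       ≡⟨ interchange (ξ F′) _ _ _ ⟩
    (ξ F′ + η F′) + (bit c + bit (not c))       ≡⟨ cong₂ _+_ ξ+η′ (bit-not c) ⟩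
    α F′ + 1                                    ≡⟨ cong (_+ 1) α-isolate ⟩
    suc (α F) + 1                               ≡⟨ sym (+-suc (α F) 1) ⟩
    α F + 2                                     ∎)
    where
    +-comm-swap : ∀ a b c → a + b + c ≡ (a + c) + b
    +-comm-swap = solve-∀
  σ+η : σ F + η F ≡ μ F
  σ+η = begin
    σ F + η F                                   ≡⟨ cong₂ _+_ σ-step η-step ⟩
    (σ F′ + bit c) + (η F′ + bit (not c))       ≡⟨ interchange (σ F′) _ _ _ ⟩
    (σ F′ + η F′) + (bit c + bit (not c))       ≡⟨ cong₂ _+_ σ+η′ (bit-not c) ⟩
    μ F′ + 1                                    ≡⟨ +-comm (μ F′) 1 ⟩
    suc (μ F′)                                  ≡⟨ sym μ-step ⟩
    μ F                                         ∎
  α+μ : α F + μ F ≡ n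
  α+μ = begin
    α F + μ F                                   ≡⟨ cong (α F +_) μ-step ⟩
    α F + suc (μ F′)                            ≡⟨ +-suc (α F) (μ F′) ⟩
    suc (α F) + μ F′                            ≡⟨ cong (_+ μ F′) (sym α-isolate) ⟩
    α F′ + μ F′                                 ≡⟨ α+μ′ ⟩
    n                                           ∎

card-full : ∀ {n} → card {n} (λ _ → true) ≡ n
card-full {n} = trans (count-true (allFin n)) (length-tabulate id)
  where
  count-true : ∀ xs → count (λ (_ : Fin n) → true) xs ≡ length xs
  count-true []       = refl
  count-true (x ∷ xs) = cong suc (count-true xs)

edges-empty? : ∀ {n} (G : Graph n) → edges G ≡ [] ⊎ ∃₂ λ u v → G u v ≡ true
edges-empty? G with edges G in es
... | []          = inj₁ refl
... | (u , v) ∷ _ = inj₂ (u , v , ∈-edges⁻ G (subst ((u , v) ∈_) (sym es) (here refl)))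

edgeless : ∀ {n} {G : Graph n} → Simple G → edges G ≡ [] → ∀ i j → G i j ≡ false
edgeless {G = G} simple none i j = ≢true⇒≡false λ Gij → go Gij (<-cmp (toℕ i) (toℕ j))
  where
  listed : ∀ {e} → e ∈ edges G → ⊥
  listed e∈ = case subst (_ ∈_) none e∈ of λ ()
  go : G i j ≡ true → Tri (toℕ i < toℕ j) (toℕ i ≡ toℕ j) (toℕ j < toℕ i) → ⊥
  go Gij (tri< i<j _ _) = listed (∈-edges⁺ G (Equivalence.to T-≡ (<⇒<ᵇ i<j)) Gij)
  go Gij (tri≈ _ i≡j _) with refl ← toℕ-injective i≡j = case trans (sym Gij) (proj₂ simple i) of λ ()
  go Gij (tri> _ _ j<i) = listed (∈-edges⁺ G (Equivalence.to T-≡ (<⇒<ᵇ j<i)) (trans (proj₁ simple j i) Gij))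

identities-edgeless : ∀ {n} {G : Graph n} → Simple G → edges G ≡ [] → ForestIdentities G
identities-edgeless {n} {G} simple none =
  trans (cong₂ _+_ ξG ηG) (trans (+-identityʳ n) (sym αG)) ,
  trans (cong₂ _+_ σG ηG) (sym μG) ,
  trans (cong₂ _+_ αG μG) (+-identityʳ n)
  where
  in-every-maxStable : ∀ v {S} → MaxStable G S → S v ≡ true
  in-every-maxStable v = isolated⇒∈maxStable simple (edgeless simple none v)
  αG : α G ≡ n
  αG with S , _ , card≡ ← maxStable-exists G =
    ≤-antisym (subst (_≤ n) card≡ (card-≤ S))
              (subst (_≤ α G) card-full (stable⇒card≤α G λ i j _ _ → edgeless simple none i j))
  ξG : ξ G ≡ n
  ξG = trans (count-cong (λ v → inCore-complete G λ _ → in-every-maxStable v) (allFin n)) card-full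
  σG : σ G ≡ 0
  σG with _ , ms ← maxStable-exists G = count-false (λ v → outsideCorona-false G ms (in-every-maxStable v ms)) (allFin n)
  ηG : η G ≡ 0
  ηG = cong (count (isαCritical G)) none
  μG : μ G ≡ 0
  μG = cong (λ es → maxℕ (map length (filter isMatching (sublists es)))) none

acyclic-isolate : ∀ {n} {G : Graph n} p → Acyclic G → Acyclic (isolate p G)
acyclic-isolate p acyclic (x , vs , length≥2 , unique , linked) =
  acyclic (x , vs , length≥2 , unique , Linked.map (∧-conicalˡ _ _) linked)

forest-identities : ∀ {n} {G : Graph n} → Simple G → Acyclic G → ForestIdentities G
forest-identities {G = G} simple acyclic = on-edges (suc (length (edges G))) simple acyclic ≤-refl
  where
  on-edges : ∀ k {n} {G : Graph n} → Simple G → Acyclic G → length (edges G) < k → ForestIdentities G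
  on-edges (suc k) {G = G} simple acyclic bound with edges-empty? G
  ... | inj₁ none = identities-edgeless simple none
  ... | inj₂ (u , v , Guv) with ℓ , p , pendant ← pendant-exists simple acyclic Guv =
    identities-step simple pendant
      (on-edges k (simple-isolate p simple) (acyclic-isolate p acyclic)
                  (≤-trans (PendantReduction.fewer-edges simple pendant) (≤-pred bound)))

corollary4p5 : ∀ (n : ℕ) (T : Graph n) → IsTree T → HasEdge T →
    (ξ T + η T ≡ α T) × (σ T + η T ≡ μ T) × (ξ T + 2 * η T + σ T ≡ n)
corollary4p5 n T (simple , _ , acyclic) _ with ξ+η≡α , σ+η≡μ , α+μ≡n ← forest-identities simple acyclic =
  ξ+η≡α , σ+η≡μ , (begin
    ξ T + 2 * η T + σ T       ≡⟨ regroup (ξ T) (η T) (σ T) ⟩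
    (ξ T + η T) + (σ T + η T) ≡⟨ cong₂ _+_ ξ+η≡α σ+η≡μ ⟩
    α T + μ T                 ≡⟨ α+μ≡n ⟩
    n                         ∎)
  where
  open ≡-Reasoning
  regroup : ∀ x e s → x + 2 * e + s ≡ (x + e) + (s + e)
  regroup = solve-∀
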